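{- Let $R=\{(0,2),(0,3),(2,0),(2,2),(2,3),(3,0),(3,2),(3,3)\}$. Then $(123,R)\sim_d(132,R)$.
   Context: $S_n$ denotes the set of permutations of $[n]=\{1,\dots,n\}$, written $\pi=\pi_1\cdots\pi_n$. A mesh pattern of length $k$ is a pair $(\tau,R)$ with $\tau\in S_k$ and $R\subseteq\{0,1,\dots,k\}^2$ (the shaded boxes; box $(a,b)$ is the unit square $[a,a+1]\times[b,b+1]$ in the diagram of $\tau$). An occurrence of $(\tau,R)$ in $\pi\in S_n$ is a choice of indices $i_1<\dots<i_k$ such that $\pi_{i_1}\cdots\pi_{i_k}$ is order-isomorphic to $\tau$ and, with $i_0=0$, $i_{k+1}=n+1$, $v_1<\dots<v_k$ the values $\pi_{i_1},\dots,\pi_{i_k}$ sorted increasingly, $v_0=0$, $v_{k+1}=n+1$, for every $(a,b)\in R$ there is no index $m$ with $i_a<m<i_{a+1}$ and $v_b<\pi_m<v_{b+1}$. Mesh patterns $p,q$ are equidistributed, $p\sim_d q$, if for all $n,\ell\ge0$ the number of $\pi\in S_n$ with exactly $\ell$ occurrences of $p$ equals the number with exactly $\ell$ occurrences of $q$. -}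

module Defs where

open import Data.Nat using (ℕ; zero; suc; _<_; _<ᵇ_; _≡ᵇ_; _+_)
open import Data.Bool using (Bool; true; false; _∧_; _∨_; not; if_then_else_)
open import Data.List using (List; []; _∷_; map; concatMap; length; filter; upTo)
open import Data.Bool.ListAction using (and; all; any)
open import Data.Product using (_×_; _,_; proj₁; proj₂)
open import Relation.Nullary using (Dec; yes; no)
open import Relation.Binary.PropositionalEquality using (_≡_)

-- Words and permutations are lists of natural numbers, written
-- π = π₁ ⋯ πₙ (1-based values, as in the paper).

-- position lookup, 1-based; returns 0 outside the range 1..length
at : List ℕ → ℕ → ℕ
at []       _             = 0
at (x ∷ xs) zero          = 0
at (x ∷ xs) (suc zero)    = x
at (x ∷ xs) (suc (suc i)) = at xs (suc i)

range1 : ℕ → List ℕ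
range1 n = map suc (upTo n)

words : List ℕ → ℕ → List (List ℕ)
words A zero    = [] ∷ []
words A (suc k) = concatMap (λ a → map (a ∷_) (words A k)) A

elemᵇ : ℕ → List ℕ → Bool
elemᵇ x []       = false
elemᵇ x (y ∷ ys) = (x ≡ᵇ y) ∨ elemᵇ x ys

distinctᵇ : List ℕ → Bool
distinctᵇ []       = true
distinctᵇ (x ∷ xs) = not (elemᵇ x xs) ∧ distinctᵇ xs

S : ℕ → List (List ℕ)
S n = filter (λ w → Data.Bool._≟_ (distinctᵇ w) true) (words (range1 n) n)

increasingᵇ : List ℕ → Bool
increasingᵇ []           = true
increasingᵇ (x ∷ [])     = true
increasingᵇ (x ∷ y ∷ xs) = (x <ᵇ y) ∧ increasingᵇ (y ∷ xs)

indexSeqs : ℕ → ℕ → List (List ℕ)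
indexSeqs n k = filter (λ w → Data.Bool._≟_ (increasingᵇ w) true) (words (range1 n) k)

orderIsoᵇ : List ℕ → List ℕ → Bool
orderIsoᵇ u v =
  and (map (λ a → and (map (λ b →
        (at u a <ᵇ at u b) ≡ᵇᴮ (at v a <ᵇ at v b)) (range1 (length u)))) (range1 (length u)))
  ∧ (length u ≡ᵇ length v)
  where
  _≡ᵇᴮ_ : Bool → Bool → Bool
  true  ≡ᵇᴮ b = b
  false ≡ᵇᴮ b = not b

insert : ℕ → List ℕ → List ℕ
insert x []       = x ∷ []
insert x (y ∷ ys) = if x <ᵇ y then x ∷ y ∷ ys else y ∷ insert x ys

sort : List ℕ → List ℕ
sort []       = []
sort (x ∷ xs) = insert x (sort xs)

record MeshPattern : Set where
  constructor mesh
  field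
    τ : List ℕ
    R : List (ℕ × ℕ)

-- i_0 = 0, i_1..i_k, i_{k+1} = n+1 ; similarly for values
extend : ℕ → List ℕ → List ℕ
extend n is = 0 ∷ Data.List._++_ is (suc n ∷ [])

-- get the j-th entry (0-based) of a list, 0 if out of range
nth : List ℕ → ℕ → ℕ
nth []       _       = 0
nth (x ∷ xs) zero    = x
nth (x ∷ xs) (suc j) = nth xs j

boxEmptyᵇ : List ℕ → List ℕ → List ℕ → ℕ × ℕ → Bool
boxEmptyᵇ π I V (a , b) =
  not (any (λ m → (nth I a <ᵇ m) ∧ (m <ᵇ nth I (suc a))
                ∧ (nth V b <ᵇ at π m) ∧ (at π m <ᵇ nth V (suc b)))
           (range1 (length π)))

isOccurrenceᵇ : MeshPattern → List ℕ → List ℕ → Bool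
isOccurrenceᵇ p π is =
  orderIsoᵇ vals (MeshPattern.τ p)
  ∧ all (boxEmptyᵇ π (extend n is) (extend n (sort vals))) (MeshPattern.R p)
  where
  n    = length π
  vals = map (at π) is

occ : MeshPattern → List ℕ → ℕ
occ p π = length (filter (λ is → Data.Bool._≟_ (isOccurrenceᵇ p π is) true)
                         (indexSeqs (length π) (length (MeshPattern.τ p))))

count : MeshPattern → ℕ → ℕ → ℕ
count p n ℓ = length (filter (λ π → occ p π Data.Nat.≟ ℓ) (S n))

_∼d_ : MeshPattern → MeshPattern → Set
p ∼d q = (n ℓ : ℕ) → count p n ℓ ≡ count q n ℓ

R48 : List (ℕ × ℕ)
R48 = (0 , 2) ∷ (0 , 3) ∷ (2 , 0) ∷ (2 , 2) ∷ (2 , 3) ∷ (3 , 0) ∷ (3 , 2) ∷ (3 , 3) ∷ []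

{-# OPTIONS --safe #-}
-- For an occurrence of (123,R) or (132,R) at positions i < j < k the shading says: every letter left of i
-- lies below the middle value, and every letter right of j other than π_k lies strictly between the
-- smallest and the middle value. Hence π_j and π_k are the two largest letters of the suffix π_j ⋯ π_n,
-- π_j being the second largest for (123,R) and the largest for (132,R).
--
-- The bijection φ reads a word from left to right and, whenever the current letter is one of the two
-- largest letters of the remaining suffix, exchanges these two letters. The admissible first positions of
-- an occurrence with middle position j depend only on the letters before j and on the set of letters from
-- j on, so the exchange at j turns the (123,R)-occurrences with middle position j into the (132,R)-ones,
-- and the relabelling it causes further right changes neither count for later middle positions. Moreover
-- no occurrence of either pattern starts at or after a position where an exchange takes place. Hence
-- φ carries the number of occurrences of (123,R) to that of (132,R), and φ is an involution of S_n.
module Submission where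

open import Defs
open import Data.Bool using (Bool; true; false; _∧_; _∨_; not; if_then_else_; T)
import Data.Bool as Bool
open import Data.Bool.ListAction using (all; any)
open import Data.Bool.Properties using (T-≡; T-∨; ∧-zeroʳ; ∧-assoc)
open import Data.List using (List; []; _∷_; map; length; filter; concatMap; _++_; upTo; applyUpTo; cartesianProductWith)
open import Data.List.Properties using (length-map; map-∘; map-id-local; map-cong-local; ≡-dec; map-upTo; ∷-injective)
open import Data.List.Membership.Propositional using (_∈_; _∉_)
open import Data.List.Membership.Propositional.Properties
  using (∈-map⁺; ∈-map⁻; ∈-filter⁺; ∈-filter⁻; ∈-upTo⁺; ∈-upTo⁻)
open import Data.List.Membership.Propositional.Properties
  using (∈-cartesianProductWith⁺; ∈-cartesianProductWith⁻)
open import Data.List.Membership.Propositional.Properties.WithK using (unique∧set⇒bag)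
open import Data.List.Relation.Unary.All as All using (All; []; _∷_)
import Data.List.Relation.Unary.All.Properties as All
open import Data.List.Relation.Unary.All.Properties using (All¬⇒¬Any; ¬Any⇒All¬)
open import Data.List.Relation.Unary.Any using (here; there)
open import Data.List.Relation.Unary.AllPairs as AllPairs using ([]; _∷_)
open import Data.List.Relation.Unary.Unique.Propositional using (Unique)
import Data.List.Relation.Unary.Unique.Propositional.Properties as Unique
import Data.List.Relation.Binary.Permutation.Propositional as ↭
open ↭ using (_↭_; ↭-refl; ↭-prep; ↭-swap; ↭-trans; ↭-sym)
open import Data.List.Relation.Binary.Permutation.Propositional.Properties
  using (∈-resp-↭; All-resp-↭; ↭-length; ↭-empty-inv; filter-↭)
import Data.List.Relation.Binary.Permutation.Setoid.Properties as ↭ₛ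
open import Data.List.Relation.Binary.BagAndSetEquality using (∼bag⇒↭)
open import Data.Nat using (ℕ; zero; suc; _+_; _<_; _≤_; _⊔_; _<ᵇ_; _≡ᵇ_; _≟_; _<?_; z≤n; s≤s)
import Data.Nat as ℕ
open import Data.Nat.Properties
open import Data.List.Membership.DecPropositional _≟_ using (_∈?_)
open import Data.Product using (_×_; _,_; proj₁; proj₂)
open import Data.Sum using (_⊎_; inj₁; inj₂; [_,_]′; map₂)
open import Function using (_∘_; _⇔_; mk⇔; Equivalence)
open import Relation.Nullary using (¬_; Dec; yes; no; does; contradiction)
open import Relation.Nullary.Decidable using (dec-true; dec-false; ¬?; _×-dec_; _⊎-dec_)
open import Relation.Binary.PropositionalEquality
open import Relation.Binary.Definitions using (tri<; tri≈; tri>)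

-- Largest letters and relabellings

maximum : List ℕ → ℕ
maximum []       = 0
maximum (x ∷ xs) = x ⊔ maximum xs

≤-maximum : ∀ {x xs} → x ∈ xs → x ≤ maximum xs
≤-maximum {xs = y ∷ ys} (here refl) = m≤m⊔n y (maximum ys)
≤-maximum {xs = y ∷ ys} (there x∈) = ≤-trans (≤-maximum x∈) (m≤n⊔m y (maximum ys))

maximum-∈ : ∀ {xs} → xs ≢ [] → maximum xs ∈ xs
maximum-∈ {[]}     xs≢[] = contradiction refl xs≢[]
maximum-∈ {x ∷ xs} _     = ∷-maximum-∈ x xs
  where
  ∷-maximum-∈ : ∀ x xs → maximum (x ∷ xs) ∈ x ∷ xs
  ∷-maximum-∈ x [] rewrite ⊔-identityʳ x = here refl
  ∷-maximum-∈ x (y ∷ ys) with ⊔-sel x (maximum (y ∷ ys))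
  ... | inj₁ x⊔m≡x = here x⊔m≡x
  ... | inj₂ x⊔m≡m = there (subst (_∈ y ∷ ys) (sym x⊔m≡m) (∷-maximum-∈ y ys))

∈⇒≢[] : ∀ {A : Set} {x : A} {xs} → x ∈ xs → xs ≢ []
∈⇒≢[] (here _)  ()
∈⇒≢[] (there _) ()

maximum-≡ : ∀ {m xs} → m ∈ xs → (∀ {x} → x ∈ xs → x ≤ m) → maximum xs ≡ m
maximum-≡ m∈xs ≤m = ≤-antisym (≤m (maximum-∈ (∈⇒≢[] m∈xs))) (≤-maximum m∈xs)

<maximum⇒≢[] : ∀ {b zs} → b < maximum zs → zs ≢ []
<maximum⇒≢[] () refl

<maximum⇒∈ : ∀ {b zs} → b < maximum zs → maximum zs ∈ zs
<maximum⇒∈ = maximum-∈ ∘ <maximum⇒≢[]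

maximum-∷-cases : ∀ z zs →
  (maximum zs ≤ z × maximum (z ∷ zs) ≡ z) ⊎ (z < maximum zs × maximum (z ∷ zs) ≡ maximum zs)
maximum-∷-cases z zs with ≤-<-connex (maximum zs) z
... | inj₁ m≤z = inj₁ (m≤z , m≥n⇒m⊔n≡m m≤z)
... | inj₂ z<m = inj₂ (z<m , m≤n⇒m⊔n≡n (<⇒≤ z<m))

maximum-↭ : ∀ {xs ys} → xs ↭ ys → maximum xs ≡ maximum ys
maximum-↭ ↭.refl = refl
maximum-↭ (↭.prep x p) = cong (x ⊔_) (maximum-↭ p)
maximum-↭ (↭.swap {xs} {ys} x y p) = begin
  x ⊔ (y ⊔ maximum xs)  ≡⟨ cong (λ m → x ⊔ (y ⊔ m)) (maximum-↭ p) ⟩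
  x ⊔ (y ⊔ maximum ys)  ≡⟨ ⊔-assoc x y _ ⟨
  (x ⊔ y) ⊔ maximum ys  ≡⟨ cong (_⊔ maximum ys) (⊔-comm x y) ⟩
  (y ⊔ x) ⊔ maximum ys  ≡⟨ ⊔-assoc y x _ ⟩
  y ⊔ (x ⊔ maximum ys)  ∎
  where open ≡-Reasoning
maximum-↭ (↭.trans p q) = trans (maximum-↭ p) (maximum-↭ q)

head∉tail : ∀ {x : ℕ} {xs} → Unique (x ∷ xs) → x ∉ xs
head∉tail (x≢xs ∷ _) = All¬⇒¬Any x≢xs

Unique-resp-↭ : ∀ {xs ys} → xs ↭ ys → Unique xs → Unique ys
Unique-resp-↭ p = ↭ₛ.Unique-resp-↭ (setoid ℕ) (↭.↭⇒↭ₛ {A = ℕ} p)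

relabel : ℕ → ℕ → ℕ → ℕ
relabel M y z = if does (z ≟ M) then y else z

replace : ℕ → ℕ → List ℕ → List ℕ
replace M y = map (relabel M y)

relabel-≡ : ∀ M y → relabel M y M ≡ y
relabel-≡ M y rewrite dec-true (M ≟ M) refl = refl

relabel-≢ : ∀ {M y z} → z ≢ M → relabel M y z ≡ z
relabel-≢ {M} {y} {z} z≢M rewrite dec-false (z ≟ M) z≢M = refl

replace-∈⁻ : ∀ {M y z zs} → z ∈ replace M y zs → (z ≡ y × M ∈ zs) ⊎ (z ∈ zs × z ≢ M)
replace-∈⁻ {M} {y} z∈ with ∈-map⁻ (relabel M y) z∈
... | x , x∈zs , refl with x ≟ M
...   | yes refl = inj₁ (relabel-≡ x y , x∈zs)
...   | no  x≢M  rewrite relabel-≢ {y = y} x≢M = inj₂ (x∈zs , x≢M)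

replace-∉ : ∀ {M y zs} → M ∉ zs → replace M y zs ≡ zs
replace-∉ {M} {zs = zs} M∉zs =
  map-id-local (All.tabulate (λ z∈ → relabel-≢ (λ { refl → M∉zs z∈ })))

replace-involutive : ∀ {M y zs} → y ∉ zs → replace y M (replace M y zs) ≡ zs
replace-involutive {M} {y} {zs} y∉zs = begin
  replace y M (replace M y zs)         ≡⟨ map-∘ zs ⟨
  map (relabel y M ∘ relabel M y) zs   ≡⟨ map-id-local (All.tabulate back) ⟩
  zs                                   ∎
  where
  open ≡-Reasoning
  back : ∀ {z} → z ∈ zs → relabel y M (relabel M y z) ≡ z
  back {z} z∈ with z ≟ M
  ... | yes refl rewrite relabel-≡ z y = relabel-≡ y z
  ... | no  z≢M  rewrite relabel-≢ {y = y} z≢M = relabel-≢ (λ { refl → y∉zs z∈ })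

replace-↭ : ∀ {M y zs} → Unique zs → M ∈ zs → y ∷ zs ↭ M ∷ replace M y zs
replace-↭ {M} {y} (M∉zs ∷ _) (here refl)
  rewrite relabel-≡ M y | replace-∉ {y = y} (All¬⇒¬Any M∉zs) = ↭-swap y M ↭-refl
replace-↭ {M} {y} {z ∷ zs} (z∉zs ∷ u) (there M∈zs)
  rewrite relabel-≢ {y = y} (All.lookup z∉zs M∈zs) =
  ↭-trans (↭-swap y z ↭-refl) (↭-trans (↭-prep z (replace-↭ u M∈zs)) (↭-swap z M ↭-refl))

-- The involution φ

TopTwo : ℕ → List ℕ → Set
TopTwo y zs = zs ≢ [] × All (λ z → z ≡ maximum zs ⊎ z < y) zs

topTwo? : ∀ y zs → Dec (TopTwo y zs)
topTwo? y zs = ¬? (≡-dec _≟_ zs []) ×-dec All.all? (λ z → (z ≟ maximum zs) ⊎-dec (z <? y)) zs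

TopTwo-resp-↭ : ∀ {y xs ys} → xs ↭ ys → TopTwo y xs → TopTwo y ys
TopTwo-resp-↭ {y} p (xs≢[] , top) =
  (λ { refl → xs≢[] (↭-empty-inv p) }) ,
  All-resp-↭ p (subst (λ m → All (λ z → z ≡ m ⊎ z < y) _) (maximum-↭ p) top)

topTwo-maximum-∈ : ∀ {y zs} → TopTwo y zs → maximum zs ∈ zs
topTwo-maximum-∈ = maximum-∈ ∘ proj₁

length-induction : (P : List ℕ → Set) → P [] →
                   (∀ y zs → (∀ w → length w ≡ length zs → P w) → P (y ∷ zs)) → ∀ w → P w
length-induction P P[] step w = go w refl
  where
  go : ∀ {n} w → length w ≡ n → P w
  go         []       _  = P[]
  go {zero}  (y ∷ zs) ()
  go {suc n} (y ∷ zs) eq = step y zs (λ w eq′ → go w (trans eq′ (suc-injective eq)))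

-- After an exchange the recursion continues on a relabelled tail, so it runs on fuel.
φ-fuel : ℕ → List ℕ → List ℕ
φ-fuel zero    w        = w
φ-fuel (suc f) []       = []
φ-fuel (suc f) (y ∷ zs) =
  if does (topTwo? y zs)
  then maximum zs ∷ φ-fuel f (replace (maximum zs) y zs)
  else y ∷ φ-fuel f zs

φ : List ℕ → List ℕ
φ w = φ-fuel (length w) w

φ-swap : ∀ {y zs} → TopTwo y zs → φ (y ∷ zs) ≡ maximum zs ∷ φ (replace (maximum zs) y zs)
φ-swap {y} {zs} t rewrite dec-true (topTwo? y zs) t | length-map (relabel (maximum zs) y) zs = refl

φ-keep : ∀ {y zs} → ¬ TopTwo y zs → φ (y ∷ zs) ≡ y ∷ φ zs
φ-keep {y} {zs} ¬t rewrite dec-false (topTwo? y zs) ¬t = refl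

φ-↭ : ∀ w → Unique w → φ w ↭ w
φ-↭ = length-induction (λ w → Unique w → φ w ↭ w) (λ _ → ↭-refl) step
  where
  step : ∀ y zs → (∀ w → length w ≡ length zs → Unique w → φ w ↭ w) →
         Unique (y ∷ zs) → φ (y ∷ zs) ↭ y ∷ zs
  step y zs ih u with topTwo? y zs
  ... | no ¬t = subst (_↭ y ∷ zs) (sym (φ-keep ¬t)) (↭-prep y (ih zs refl (AllPairs.tail u)))
  ... | yes t = subst (_↭ y ∷ zs) (sym (φ-swap t))
                  (↭-trans (↭-prep _ (ih _ (length-map _ zs) (AllPairs.tail u′))) (↭-sym swapped))
    where
    swapped : y ∷ zs ↭ maximum zs ∷ replace (maximum zs) y zs
    swapped = replace-↭ (AllPairs.tail u) (topTwo-maximum-∈ t)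
    u′ : Unique (maximum zs ∷ replace (maximum zs) y zs)
    u′ = Unique-resp-↭ swapped u

φ-∈ : ∀ {w z} → Unique w → z ∈ φ w → z ∈ w
φ-∈ {w} u = ∈-resp-↭ (φ-↭ w u)

StrictlyIncreasingOn : (ℕ → ℕ) → List ℕ → Set
StrictlyIncreasingOn f w = ∀ {a b} → a ∈ w → b ∈ w → a < b → f a < f b

module _ {f : ℕ → ℕ} {w : List ℕ} (mono : StrictlyIncreasingOn f w) where

  mono-≤ : ∀ {a b} → a ∈ w → b ∈ w → a ≤ b → f a ≤ f b
  mono-≤ a∈ b∈ a≤b with m≤n⇒m<n∨m≡n a≤b
  ... | inj₁ a<b  = <⇒≤ (mono a∈ b∈ a<b)
  ... | inj₂ refl = ≤-refl

  mono-<⁻ : ∀ {a b} → a ∈ w → b ∈ w → f a < f b → a < b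
  mono-<⁻ a∈ b∈ fa<fb = ≰⇒> (λ b≤a → <⇒≱ fa<fb (mono-≤ b∈ a∈ b≤a))

  mono-injective : ∀ {a b} → a ∈ w → b ∈ w → f a ≡ f b → a ≡ b
  mono-injective {a} {b} a∈ b∈ fa≡fb with <-cmp a b
  ... | tri< a<b _ _ = contradiction fa≡fb (<⇒≢ (mono a∈ b∈ a<b))
  ... | tri≈ _ a≡b _ = a≡b
  ... | tri> _ _ b<a = contradiction (sym fa≡fb) (<⇒≢ (mono b∈ a∈ b<a))

StrictlyIncreasingOn-⊆ : ∀ {f v w} → StrictlyIncreasingOn f w → (∀ {x} → x ∈ v → x ∈ w) →
                         StrictlyIncreasingOn f v
StrictlyIncreasingOn-⊆ mono v⊆w a∈ b∈ = mono (v⊆w a∈) (v⊆w b∈)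

module _ {f : ℕ → ℕ} where

  maximum-map : ∀ {zs} → StrictlyIncreasingOn f zs → zs ≢ [] → maximum (map f zs) ≡ f (maximum zs)
  maximum-map {zs} mono zs≢[] = maximum-≡ (∈-map⁺ f M∈) bound
    where
    M∈ : maximum zs ∈ zs
    M∈ = maximum-∈ zs≢[]
    bound : ∀ {x} → x ∈ map f zs → x ≤ f (maximum zs)
    bound x∈ with ∈-map⁻ f x∈
    ... | z , z∈ , refl = mono-≤ mono z∈ M∈ (≤-maximum z∈)

  map≢[] : ∀ {zs : List ℕ} → zs ≢ [] → map f zs ≢ []
  map≢[] {[]}    zs≢[] _ = zs≢[] refl
  map≢[] {_ ∷ _} _     ()

  module _ {y : ℕ} {zs : List ℕ} (mono : StrictlyIncreasingOn f (y ∷ zs)) where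

    private
      mono-zs : StrictlyIncreasingOn f zs
      mono-zs = StrictlyIncreasingOn-⊆ mono there

    topTwo-map⁺ : TopTwo y zs → TopTwo (f y) (map f zs)
    topTwo-map⁺ (zs≢[] , top) = map≢[] zs≢[] , All.map⁺ (All.tabulate image)
      where
      image : ∀ {z} → z ∈ zs → f z ≡ maximum (map f zs) ⊎ f z < f y
      image z∈ with All.lookup top z∈
      ... | inj₁ refl = inj₁ (sym (maximum-map mono-zs zs≢[]))
      ... | inj₂ z<y  = inj₂ (mono (there z∈) (here refl) z<y)

    topTwo-map⁻ : TopTwo (f y) (map f zs) → TopTwo y zs
    topTwo-map⁻ (fzs≢[] , top) = zs≢[] , All.tabulate preimage
      where
      zs≢[] : zs ≢ []
      zs≢[] refl = fzs≢[] refl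
      preimage : ∀ {z} → z ∈ zs → z ≡ maximum zs ⊎ z < y
      preimage z∈ with All.lookup (All.map⁻ top) z∈
      ... | inj₁ fz≡max = inj₁ (mono-injective mono-zs z∈ (maximum-∈ zs≢[])
                                  (trans fz≡max (maximum-map mono-zs zs≢[])))
      ... | inj₂ fz<fy  = inj₂ (mono-<⁻ mono (there z∈) (here refl) fz<fy)

    replace-map : ∀ {M} → M ∈ zs → replace (f M) (f y) (map f zs) ≡ map f (replace M y zs)
    replace-map {M} M∈ = begin
      replace (f M) (f y) (map f zs)      ≡⟨ map-∘ zs ⟨
      map (relabel (f M) (f y) ∘ f) zs    ≡⟨ map-cong-local (All.tabulate pointwise) ⟩
      map (f ∘ relabel M y) zs            ≡⟨ map-∘ zs ⟩
      map f (replace M y zs)              ∎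
      where
      open ≡-Reasoning
      pointwise : ∀ {z} → z ∈ zs → relabel (f M) (f y) (f z) ≡ f (relabel M y z)
      pointwise {z} z∈ with z ≟ M
      ... | yes refl rewrite relabel-≡ z y = relabel-≡ (f z) (f y)
      ... | no  z≢M  rewrite relabel-≢ {y = y} z≢M = relabel-≢ (z≢M ∘ mono-injective mono-zs z∈ M∈)

φ-map : ∀ w f → StrictlyIncreasingOn f w → φ (map f w) ≡ map f (φ w)
φ-map = length-induction Claim (λ _ _ → refl) step
  where
  Claim : List ℕ → Set
  Claim w = ∀ f → StrictlyIncreasingOn f w → φ (map f w) ≡ map f (φ w)
  step : ∀ y zs → (∀ w → length w ≡ length zs → Claim w) → Claim (y ∷ zs)
  step y zs ih f mono with topTwo? y zs
  ... | no ¬t = begin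
    φ (f y ∷ map f zs)    ≡⟨ φ-keep (¬t ∘ topTwo-map⁻ mono) ⟩
    f y ∷ φ (map f zs)    ≡⟨ cong (f y ∷_) (ih zs refl f (StrictlyIncreasingOn-⊆ mono there)) ⟩
    f y ∷ map f (φ zs)    ≡⟨ cong (map f) (φ-keep ¬t) ⟨
    map f (φ (y ∷ zs))    ∎
    where open ≡-Reasoning
  ... | yes t = begin
    φ (f y ∷ map f zs)
      ≡⟨ φ-swap (topTwo-map⁺ mono t) ⟩
    maximum (map f zs) ∷ φ (replace (maximum (map f zs)) (f y) (map f zs))
      ≡⟨ cong (λ m → m ∷ φ (replace m (f y) (map f zs))) max-f ⟩
    f M ∷ φ (replace (f M) (f y) (map f zs))
      ≡⟨ cong (λ v → f M ∷ φ v) (replace-map mono M∈) ⟩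
    f M ∷ φ (map f (replace M y zs))
      ≡⟨ cong (f M ∷_) (ih _ (length-map _ zs) f mono′) ⟩
    f M ∷ map f (φ (replace M y zs))
      ≡⟨ cong (map f) (φ-swap t) ⟨
    map f (φ (y ∷ zs)) ∎
    where
    open ≡-Reasoning
    M : ℕ
    M = maximum zs
    M∈ : M ∈ zs
    M∈ = topTwo-maximum-∈ t
    max-f : maximum (map f zs) ≡ f M
    max-f = maximum-map (StrictlyIncreasingOn-⊆ mono there) (proj₁ t)
    mono′ : StrictlyIncreasingOn f (replace M y zs)
    mono′ = StrictlyIncreasingOn-⊆ mono λ z∈ →
      [ (λ { (refl , _) → here refl }) , there ∘ proj₁ ]′ (replace-∈⁻ z∈)

module TopTwoSwap {y : ℕ} {zs : List ℕ} (t : TopTwo y zs) (u : Unique (y ∷ zs)) where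

  M : ℕ
  M = maximum zs

  zs′ : List ℕ
  zs′ = replace M y zs

  M∈zs : M ∈ zs
  M∈zs = topTwo-maximum-∈ t

  y∉zs : y ∉ zs
  y∉zs = head∉tail u

  below : ∀ {z} → z ∈ zs → z ≢ M → z < y × z < M
  below z∈ z≢M with All.lookup (proj₂ t) z∈
  ... | inj₁ z≡M = contradiction z≡M z≢M
  ... | inj₂ z<y = z<y , ≤∧≢⇒< (≤-maximum z∈) z≢M

  swapped : y ∷ zs ↭ M ∷ zs′
  swapped = replace-↭ (AllPairs.tail u) M∈zs

  unique′ : Unique zs′
  unique′ = AllPairs.tail (Unique-resp-↭ swapped u)

  y∈zs′ : y ∈ zs′
  y∈zs′ = subst (_∈ zs′) (relabel-≡ M y) (∈-map⁺ (relabel M y) M∈zs)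

  zs′-∈⁻ : ∀ {z} → z ∈ zs′ → z ≡ y ⊎ (z ∈ zs × z < y × z < M)
  zs′-∈⁻ z∈ with replace-∈⁻ z∈
  ... | inj₁ (z≡y , _)    = inj₁ z≡y
  ... | inj₂ (z∈zs , z≢M) = inj₂ (z∈zs , below z∈zs z≢M)

  zs′-∈⁺ : ∀ {z} → z ∈ zs → z ≢ M → z ∈ zs′
  zs′-∈⁺ z∈ z≢M = subst (_∈ zs′) (relabel-≢ z≢M) (∈-map⁺ (relabel M y) z∈)

  maximum-zs′ : maximum zs′ ≡ y
  maximum-zs′ = maximum-≡ y∈zs′ λ z∈ → [ ≤-reflexive , <⇒≤ ∘ proj₁ ∘ proj₂ ]′ (zs′-∈⁻ z∈)

  topTwo-zs′ : TopTwo M zs′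
  topTwo-zs′ = ∈⇒≢[] y∈zs′ , All.tabulate λ z∈ →
    [ (λ z≡y → inj₁ (trans z≡y (sym maximum-zs′))) , inj₂ ∘ proj₂ ∘ proj₂ ]′ (zs′-∈⁻ z∈)

  relabel-increasing : StrictlyIncreasingOn (relabel y M) zs′
  relabel-increasing {a} {b} a∈ b∈ a<b with zs′-∈⁻ a∈ | zs′-∈⁻ b∈
  ... | inj₁ refl | inj₁ refl = contradiction a<b (<-irrefl refl)
  ... | inj₁ refl | inj₂ (_ , b<y , _) = contradiction a<b (<-asym b<y)
  ... | inj₂ (_ , a<y , a<M) | inj₁ refl rewrite relabel-≡ y M | relabel-≢ {y} {M} (<⇒≢ a<y) = a<M
  ... | inj₂ (_ , a<y , _) | inj₂ (_ , b<y , _)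
    rewrite relabel-≢ {y} {M} (<⇒≢ a<y) | relabel-≢ {y} {M} (<⇒≢ b<y) = a<b

φ-involutive : ∀ w → Unique w → φ (φ w) ≡ w
φ-involutive = length-induction (λ w → Unique w → φ (φ w) ≡ w) (λ _ → refl) step
  where
  step : ∀ y zs → (∀ w → length w ≡ length zs → Unique w → φ (φ w) ≡ w) →
         Unique (y ∷ zs) → φ (φ (y ∷ zs)) ≡ y ∷ zs
  step y zs ih u with topTwo? y zs
  ... | no ¬t = begin
    φ (φ (y ∷ zs))   ≡⟨ cong φ (φ-keep ¬t) ⟩
    φ (y ∷ φ zs)     ≡⟨ φ-keep (¬t ∘ TopTwo-resp-↭ (φ-↭ zs u-zs)) ⟩
    y ∷ φ (φ zs)     ≡⟨ cong (y ∷_) (ih zs refl u-zs) ⟩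
    y ∷ zs           ∎
    where
    open ≡-Reasoning
    u-zs : Unique zs
    u-zs = AllPairs.tail u
  -- The second exchange brings y back to the front; relabelling y to M undoes the first exchange on the
  -- tail and commutes with φ, being increasing on zs′ as y and M exceed all other letters.
  ... | yes t = begin
    φ (φ (y ∷ zs))
      ≡⟨ cong φ (φ-swap t) ⟩
    φ (M ∷ φ zs′)
      ≡⟨ φ-swap (TopTwo-resp-↭ (↭-sym φzs′↭zs′) topTwo-zs′) ⟩
    maximum (φ zs′) ∷ φ (replace (maximum (φ zs′)) M (φ zs′))
      ≡⟨ cong (λ m → m ∷ φ (replace m M (φ zs′))) max-φzs′ ⟩
    y ∷ φ (replace y M (φ zs′))
      ≡⟨ cong (λ v → y ∷ φ v) (φ-map zs′ (relabel y M) relabel-increasing) ⟨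
    y ∷ φ (φ (replace y M zs′))
      ≡⟨ cong (λ v → y ∷ φ (φ v)) (replace-involutive y∉zs) ⟩
    y ∷ φ (φ zs)
      ≡⟨ cong (y ∷_) (ih zs refl (AllPairs.tail u)) ⟩
    y ∷ zs ∎
    where
    open ≡-Reasoning
    open TopTwoSwap t u
    φzs′↭zs′ : φ zs′ ↭ zs′
    φzs′↭zs′ = φ-↭ zs′ unique′
    max-φzs′ : maximum (φ zs′) ≡ y
    max-φzs′ = trans (maximum-↭ φzs′↭zs′) maximum-zs′

-- Counting occurrences letter by letter

𝟙 : Bool → ℕ
𝟙 true  = 1
𝟙 false = 0

⟦_⟧ : ∀ {P : Set} → Dec P → ℕ
⟦ p? ⟧ = 𝟙 (does p?)

⟦⟧-≡0 : ∀ {P : Set} (p? : Dec P) → ¬ P → ⟦ p? ⟧ ≡ 0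
⟦⟧-≡0 p? ¬p rewrite dec-false p? ¬p = refl

⟦⟧-⇔ : ∀ {P Q : Set} (p? : Dec P) (q? : Dec Q) → P ⇔ Q → ⟦ p? ⟧ ≡ ⟦ q? ⟧
⟦⟧-⇔ p? (yes q) p⇔q rewrite dec-true p? (Equivalence.from p⇔q q) = refl
⟦⟧-⇔ p? (no ¬q) p⇔q rewrite dec-false p? (¬q ∘ Equivalence.to p⇔q) = refl

⟦⟧-⊎ : ∀ {P Q R : Set} (p? : Dec P) (q? : Dec Q) (r? : Dec R) → ¬ (P × Q) → R ⇔ (P ⊎ Q) →
       ⟦ p? ⟧ + ⟦ q? ⟧ ≡ ⟦ r? ⟧
⟦⟧-⊎ (yes p) (yes q) r? ¬pq _  = contradiction (p , q) ¬pq
⟦⟧-⊎ (yes p) (no _)  r? _   r⇔ rewrite dec-true r? (Equivalence.from r⇔ (inj₁ p)) = refl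
⟦⟧-⊎ (no _)  (yes q) r? _   r⇔ rewrite dec-true r? (Equivalence.from r⇔ (inj₂ q)) = refl
⟦⟧-⊎ (no ¬p) (no ¬q) r? _   r⇔ rewrite dec-false r? ([ ¬p , ¬q ]′ ∘ Equivalence.to r⇔) = refl

if-⟦⟧ : ∀ {P Q : Set} (p? : Dec P) (q? : Dec Q) → (if does p? then ⟦ q? ⟧ else 0) ≡ ⟦ p? ×-dec q? ⟧
if-⟦⟧ (yes _) q? = refl
if-⟦⟧ (no  _) q? = refl

Between : ℕ → ℕ → ℕ → Set
Between a b z = a < z × z < b

between? : ∀ a b z → Dec (Between a b z)
between? a b z = a <? z ×-dec z <? b

-- In Occ123 L a b zs the letters a and b are the '1' and the '2' of an occurrence of (123,R), L holds the
-- letters left of a and zs those right of b: the '3' is the maximum of zs, the other letters of zs lie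
-- strictly between a and b, and the letters of L lie below b. In Occ132 L a c zs the letter c is the '3'
-- and the '2' is the maximum of zs.
Tail123 : ℕ → ℕ → List ℕ → Set
Tail123 a b zs = b < maximum zs × All (λ z → z ≡ maximum zs ⊎ Between a b z) zs

tail123? : ∀ a b zs → Dec (Tail123 a b zs)
tail123? a b zs = b <? maximum zs ×-dec All.all? (λ z → z ≟ maximum zs ⊎-dec between? a b z) zs

Occ123 : List ℕ → ℕ → ℕ → List ℕ → Set
Occ123 L a b zs = a < b × All (_< b) L × Tail123 a b zs

occ123? : ∀ L a b zs → Dec (Occ123 L a b zs)
occ123? L a b zs = a <? b ×-dec All.all? (_<? b) L ×-dec tail123? a b zs

Occ132 : List ℕ → ℕ → ℕ → List ℕ → Set
Occ132 L a c zs =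
  a < maximum zs × maximum zs < c × All (_< maximum zs) L × All (λ z → z ≡ maximum zs ⊎ a < z) zs

occ132? : ∀ L a c zs → Dec (Occ132 L a c zs)
occ132? L a c zs = a <? maximum zs ×-dec maximum zs <? c ×-dec All.all? (_<? maximum zs) L ×-dec
                   All.all? (λ z → z ≟ maximum zs ⊎-dec a <? z) zs

-- occ123 L π counts the occurrences of (123,R) inside π when π is preceded by the letters of L, and
-- occ123From L a ys those among them whose '1' is a and whose '2' and '3' lie in ys.
occ123From : List ℕ → ℕ → List ℕ → ℕ
occ123From L a []       = 0
occ123From L a (y ∷ ys) = ⟦ occ123? L a y ys ⟧ + occ123From L a ys

occ132From : List ℕ → ℕ → List ℕ → ℕ
occ132From L a []       = 0
occ132From L a (y ∷ ys) = ⟦ occ132? L a y ys ⟧ + occ132From L a ys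

occ123 : List ℕ → List ℕ → ℕ
occ123 L []       = 0
occ123 L (x ∷ xs) = occ123From L x xs + occ123 (x ∷ L) xs

occ132 : List ℕ → List ℕ → ℕ
occ132 L []       = 0
occ132 L (x ∷ xs) = occ132From L x xs + occ132 (x ∷ L) xs

AtMostOneAbove : ℕ → List ℕ → Set
AtMostOneAbove m w = ∀ {y z} → y ∈ w → z ∈ w → m < y → m < z → y ≡ z

AtMostOneAbove-tail : ∀ {m x xs} → AtMostOneAbove m (x ∷ xs) → AtMostOneAbove m xs
AtMostOneAbove-tail one y∈ z∈ = one (there y∈) (there z∈)

≤⊎∈⇒< : ∀ {m a b L} → m ≤ a ⊎ m ∈ L → a < b → All (_< b) L → m < b
≤⊎∈⇒< (inj₁ m≤a) a<b _   = ≤-<-trans m≤a a<b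
≤⊎∈⇒< (inj₂ m∈L) _   L<b = All.lookup L<b m∈L

module _ {m : ℕ} {L : List ℕ} {a : ℕ} where

  occ123From≡0 : ∀ ys → AtMostOneAbove m ys → m ≤ a ⊎ m ∈ L → occ123From L a ys ≡ 0
  occ123From≡0 []       _   _    = refl
  occ123From≡0 (y ∷ ys) one left =
    cong₂ _+_ (⟦⟧-≡0 (occ123? L a y ys) no-occ) (occ123From≡0 ys (AtMostOneAbove-tail one) left)
    where
    no-occ : ¬ Occ123 L a y ys
    no-occ (a<y , L<y , y<max , _) =
      <⇒≢ y<max (one (here refl) (there (<maximum⇒∈ y<max)) m<y (<-trans m<y y<max))
      where
      m<y : m < y
      m<y = ≤⊎∈⇒< left a<y L<y

  occ132From≡0 : ∀ ys → AtMostOneAbove m ys → m ≤ a ⊎ m ∈ L → occ132From L a ys ≡ 0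
  occ132From≡0 []       _   _    = refl
  occ132From≡0 (y ∷ ys) one left =
    cong₂ _+_ (⟦⟧-≡0 (occ132? L a y ys) no-occ) (occ132From≡0 ys (AtMostOneAbove-tail one) left)
    where
    no-occ : ¬ Occ132 L a y ys
    no-occ (a<max , max<y , L<max , _) =
      <⇒≢ max<y (one (there (<maximum⇒∈ a<max)) (here refl) m<max (<-trans m<max max<y))
      where
      m<max : m < maximum ys
      m<max = ≤⊎∈⇒< left a<max L<max

occ123≡0 : ∀ {m L} w → AtMostOneAbove m w → m ∈ L → occ123 L w ≡ 0
occ123≡0 []       _   _   = refl
occ123≡0 {m} (x ∷ xs) one m∈L = cong₂ _+_ (occ123From≡0 xs one′ (inj₂ m∈L)) (occ123≡0 xs one′ (there m∈L))
  where
  one′ : AtMostOneAbove m xs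
  one′ = AtMostOneAbove-tail one

occ132≡0 : ∀ {m L} w → AtMostOneAbove m w → m ∈ L → occ132 L w ≡ 0
occ132≡0 []       _   _   = refl
occ132≡0 {m} (x ∷ xs) one m∈L = cong₂ _+_ (occ132From≡0 xs one′ (inj₂ m∈L)) (occ132≡0 xs one′ (there m∈L))
  where
  one′ : AtMostOneAbove m xs
  one′ = AtMostOneAbove-tail one

occ123-∷≡0 : ∀ {L x} xs → AtMostOneAbove x xs → occ123 L (x ∷ xs) ≡ 0
occ123-∷≡0 xs one = cong₂ _+_ (occ123From≡0 xs one (inj₁ ≤-refl)) (occ123≡0 xs one (here refl))

occ132-∷≡0 : ∀ {L x} xs → AtMostOneAbove x xs → occ132 L (x ∷ xs) ≡ 0
occ132-∷≡0 xs one = cong₂ _+_ (occ132From≡0 xs one (inj₁ ≤-refl)) (occ132≡0 xs one (here refl))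

Occ123⇒TopTwo : ∀ {L a y zs} → Occ123 L a y zs → TopTwo y zs
Occ123⇒TopTwo (_ , _ , y<max , rest) = <maximum⇒≢[] y<max , All.map (map₂ proj₂) rest

Occ132⇒TopTwo : ∀ {L a y zs} → Occ132 L a y zs → TopTwo y zs
Occ132⇒TopTwo (a<max , max<y , _ , _) =
  <maximum⇒≢[] a<max , All.tabulate (λ z∈ → inj₂ (≤-<-trans (≤-maximum z∈) max<y))

Occ132-resp-↭ : ∀ {L a c xs ys} → xs ↭ ys → Occ132 L a c xs → Occ132 L a c ys
Occ132-resp-↭ p occ rewrite sym (maximum-↭ p) with occ
... | a<max , max<c , L<max , rest = a<max , max<c , L<max , All-resp-↭ p rest

Occ123-bounded : ∀ {L a b zs} → (∀ {z} → z ∈ zs → z ≤ b) → ¬ Occ123 L a b zs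
Occ123-bounded ≤b (_ , _ , b<max , _) = <⇒≱ b<max (≤b (<maximum⇒∈ b<max))

module _ {y : ℕ} {zs : List ℕ} (t : TopTwo y zs) (u : Unique (y ∷ zs)) where

  open TopTwoSwap t u

  Occ132-swap⇔ : ∀ {L a} → Occ132 L a M zs′ ⇔ Occ123 L a y zs
  Occ132-swap⇔ {L} {a} = mk⇔ to from
    where
    to : Occ132 L a M zs′ → Occ123 L a y zs
    to occ rewrite maximum-zs′ with occ
    ... | a<y , y<M , L<y , rest = a<y , L<y , y<M , All.tabulate middle
      where
      middle : ∀ {z} → z ∈ zs → z ≡ M ⊎ (a < z × z < y)
      middle {z} z∈ with z ≟ M
      ... | yes z≡M = inj₁ z≡M
      ... | no  z≢M with All.lookup rest (zs′-∈⁺ z∈ z≢M)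
      ...   | inj₁ refl = contradiction z∈ y∉zs
      ...   | inj₂ a<z  = inj₂ (a<z , proj₁ (below z∈ z≢M))
    from : Occ123 L a y zs → Occ132 L a M zs′
    from (a<y , L<y , y<M , rest) rewrite maximum-zs′ = a<y , y<M , L<y , All.tabulate middle
      where
      middle : ∀ {z} → z ∈ zs′ → z ≡ y ⊎ a < z
      middle z∈ with zs′-∈⁻ z∈
      ... | inj₁ z≡y = inj₁ z≡y
      ... | inj₂ (z∈zs , _ , z<M) with All.lookup rest z∈zs
      ...   | inj₁ refl       = contradiction z<M (<-irrefl refl)
      ...   | inj₂ (a<z , _)  = inj₂ a<z

module _ {M y : ℕ} where

  private
    Below : List ℕ → Set
    Below ws = ∀ {z} → z ∈ ws → z ≡ M ⊎ (z < y × z < M)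

    ≤M : ∀ {ws z} → Below ws → z ∈ ws → z ≤ M
    ≤M below z∈ = [ ≤-reflexive , <⇒≤ ∘ proj₂ ]′ (below z∈)

    ≤y : ∀ {ws z} → Below ws → z ∈ replace M y ws → z ≤ y
    ≤y below z∈ with replace-∈⁻ z∈
    ... | inj₁ (z≡y , _) = ≤-reflexive z≡y
    ... | inj₂ (z∈ws , z≢M) = [ (λ z≡M → contradiction z≡M z≢M) , <⇒≤ ∘ proj₁ ]′ (below z∈ws)

  Occ123-replace⇔ : ∀ {L a w ws} → w < y → w < M → Below ws →
                    Occ123 L a w (replace M y ws) ⇔ Occ123 L a w ws
  Occ123-replace⇔ {L} {a} {w} {ws} w<y w<M below with M ∈? ws
  ... | no M∉ws rewrite replace-∉ {y = y} M∉ws = mk⇔ (λ occ → occ) (λ occ → occ)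
  ... | yes M∈ws = mk⇔ to from
    where
    y∈ : y ∈ replace M y ws
    y∈ = subst (_∈ replace M y ws) (relabel-≡ M y) (∈-map⁺ (relabel M y) M∈ws)
    max-ws : maximum ws ≡ M
    max-ws = maximum-≡ M∈ws (≤M below)
    max-rep : maximum (replace M y ws) ≡ y
    max-rep = maximum-≡ y∈ (≤y below)
    pointwise : ∀ {z} → z ∈ ws →
      (relabel M y z ≡ y ⊎ (a < relabel M y z × relabel M y z < w)) ⇔ (z ≡ M ⊎ (a < z × z < w))
    pointwise {z} z∈ with z ≟ M | below z∈
    ... | yes refl | _ rewrite relabel-≡ z y = mk⇔ (λ _ → inj₁ refl) (λ _ → inj₁ refl)
    ... | no  z≢M | inj₁ z≡M = contradiction z≡M z≢M
    ... | no  z≢M | inj₂ (z<y , _) rewrite relabel-≢ {y = y} z≢M =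
      mk⇔ [ (λ z≡y → contradiction z≡y (<⇒≢ z<y)) , inj₂ ]′ [ (λ z≡M → contradiction z≡M z≢M) , inj₂ ]′
    to : Occ123 L a w (replace M y ws) → Occ123 L a w ws
    to occ rewrite max-rep | max-ws with occ
    ... | a<w , L<w , _ , rest =
      a<w , L<w , w<M , All.tabulate (λ z∈ → Equivalence.to (pointwise z∈) (All.lookup (All.map⁻ rest) z∈))
    from : Occ123 L a w ws → Occ123 L a w (replace M y ws)
    from occ rewrite max-rep | max-ws with occ
    ... | a<w , L<w , _ , rest =
      a<w , L<w , w<y , All.map⁺ (All.tabulate (λ z∈ → Equivalence.from (pointwise z∈) (All.lookup rest z∈)))

  occ123From-replace : ∀ {L a} ws → Below ws → occ123From L a (replace M y ws) ≡ occ123From L a ws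
  occ123From-replace [] _ = refl
  occ123From-replace {L} {a} (w ∷ ws) below with w ≟ M | below (here refl)
  ... | yes refl | _ rewrite relabel-≡ M y = cong₂ _+_
    (trans (⟦⟧-≡0 (occ123? L a y (replace M y ws)) (Occ123-bounded (≤y below′)))
           (sym (⟦⟧-≡0 (occ123? L a M ws) (Occ123-bounded (≤M below′)))))
    (occ123From-replace ws below′)
    where
    below′ : Below ws
    below′ = below ∘ there
  ... | no w≢M | inj₁ w≡M = contradiction w≡M w≢M
  ... | no w≢M | inj₂ (w<y , w<M) rewrite relabel-≢ {y = y} w≢M = cong₂ _+_
    (⟦⟧-⇔ (occ123? L a w (replace M y ws)) (occ123? L a w ws) (Occ123-replace⇔ w<y w<M (below ∘ there)))
    (occ123From-replace ws (below ∘ there))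

occ132From-φ : ∀ ys → Unique ys → ∀ L a → occ132From L a (φ ys) ≡ occ123From L a ys
occ132From-φ = length-induction Claim (λ _ _ _ → refl) step
  where
  Claim : List ℕ → Set
  Claim ys = Unique ys → ∀ L a → occ132From L a (φ ys) ≡ occ123From L a ys
  step : ∀ y zs → (∀ w → length w ≡ length zs → Claim w) → Claim (y ∷ zs)
  step y zs ih u L a with topTwo? y zs
  ... | no ¬t rewrite φ-keep ¬t = cong₂ _+_
    (trans (⟦⟧-≡0 (occ132? L a y (φ zs)) (¬t ∘ TopTwo-resp-↭ (φ-↭ zs u-zs) ∘ Occ132⇒TopTwo))
           (sym (⟦⟧-≡0 (occ123? L a y zs) (¬t ∘ Occ123⇒TopTwo))))
    (ih zs refl u-zs L a)
    where
    u-zs : Unique zs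
    u-zs = AllPairs.tail u
  ... | yes t rewrite φ-swap t = cong₂ _+_
    (trans (⟦⟧-⇔ (occ132? L a M (φ zs′)) (occ132? L a M zs′)
                 (mk⇔ (Occ132-resp-↭ (φ-↭ zs′ unique′)) (Occ132-resp-↭ (↭-sym (φ-↭ zs′ unique′)))))
           (⟦⟧-⇔ (occ132? L a M zs′) (occ123? L a y zs) (Occ132-swap⇔ t u)))
    (trans (ih zs′ (length-map _ zs) unique′ L a) (occ123From-replace zs below′))
    where
    open TopTwoSwap t u
    below′ : ∀ {z} → z ∈ zs → z ≡ M ⊎ (z < y × z < M)
    below′ {z} z∈ with z ≟ M
    ... | yes z≡M = inj₁ z≡M
    ... | no  z≢M = inj₂ (below z∈ z≢M)

occ132-φ : ∀ π → Unique π → ∀ L → occ132 L (φ π) ≡ occ123 L π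
occ132-φ []       _ L = refl
occ132-φ (x ∷ xs) u L with topTwo? x xs
... | no ¬t rewrite φ-keep ¬t =
  cong₂ _+_ (occ132From-φ xs (AllPairs.tail u) L x) (occ132-φ xs (AllPairs.tail u) (x ∷ L))
... | yes t rewrite φ-swap t =
  trans (occ132-∷≡0 (φ zs′) one-above-M) (sym (occ123-∷≡0 xs one-above-x))
  where
  open TopTwoSwap t u
  one-above-M : AtMostOneAbove M (φ zs′)
  one-above-M a∈ b∈ M<a M<b with zs′-∈⁻ (φ-∈ unique′ a∈) | zs′-∈⁻ (φ-∈ unique′ b∈)
  ... | inj₁ a≡x | inj₁ b≡x = trans a≡x (sym b≡x)
  ... | inj₂ (_ , _ , a<M) | _ = contradiction M<a (<-asym a<M)
  ... | _ | inj₂ (_ , _ , b<M) = contradiction M<b (<-asym b<M)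
  one-above-x : AtMostOneAbove x xs
  one-above-x {a} {b} a∈ b∈ x<a x<b with a ≟ M | b ≟ M
  ... | yes a≡M | yes b≡M = trans a≡M (sym b≡M)
  ... | no  a≢M | _       = contradiction x<a (<-asym (proj₁ (below a∈ a≢M)))
  ... | _       | no  b≢M = contradiction x<b (<-asym (proj₁ (below b∈ b≢M)))

Tail123-∷ : ∀ {a b z zs} → z ∉ zs →
            Tail123 a b (z ∷ zs) ⇔ ((b < z × All (Between a b) zs) ⊎ (Between a b z × Tail123 a b zs))
Tail123-∷ {a} {b} {z} {zs} z∉zs with maximum-∷-cases z zs
... | inj₁ (m≤z , max≡z) = mk⇔ (to ∘ subst Tail max≡z) (subst Tail (sym max≡z) ∘ from)
  where
  Tail : ℕ → Set
  Tail m = b < m × All (λ x → x ≡ m ⊎ Between a b x) (z ∷ zs)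
  to : Tail z → (b < z × All (Between a b) zs) ⊎ (Between a b z × Tail123 a b zs)
  to (b<z , _ ∷ rest) = inj₁ (b<z , All.tabulate λ x∈ →
    [ (λ x≡z → contradiction (subst (_∈ zs) x≡z x∈) z∉zs) , (λ btw → btw) ]′ (All.lookup rest x∈))
  from : (b < z × All (Between a b) zs) ⊎ (Between a b z × Tail123 a b zs) → Tail z
  from (inj₁ (b<z , btws))              = b<z , inj₁ refl ∷ All.map inj₂ btws
  from (inj₂ ((_ , z<b) , (b<max , _))) = contradiction (<-trans z<b b<max) (≤⇒≯ m≤z)
... | inj₂ (z<m , max≡m) = mk⇔ (to ∘ subst Tail max≡m) (subst Tail (sym max≡m) ∘ from)
  where
  Tail : ℕ → Set
  Tail m = b < m × All (λ x → x ≡ m ⊎ Between a b x) (z ∷ zs)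
  to : Tail (maximum zs) → (b < z × All (Between a b) zs) ⊎ (Between a b z × Tail123 a b zs)
  to (b<m , inj₁ z≡m ∷ _)    = contradiction z≡m (<⇒≢ z<m)
  to (b<m , inj₂ btw ∷ rest) = inj₂ (btw , b<m , rest)
  from : (b < z × All (Between a b) zs) ⊎ (Between a b z × Tail123 a b zs) → Tail (maximum zs)
  from (inj₁ (b<z , btws))         = contradiction (<-trans b<z z<m)
                                       (≤⇒≯ (<⇒≤ (proj₂ (All.lookup btws (<maximum⇒∈ (<-trans b<z z<m))))))
  from (inj₂ (btw , (b<m , rest))) = b<m , inj₂ btw ∷ rest

Occ132-∷ : ∀ {L a c z zs} → z ∉ zs →
           Occ132 L a c (z ∷ zs) ⇔
           ((a < z × z < c × All (_< z) L × All (Between a z) zs) ⊎ (a < z × Occ132 (z ∷ L) a c zs))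
Occ132-∷ {L} {a} {c} {z} {zs} z∉zs with maximum-∷-cases z zs
... | inj₁ (m≤z , max≡z) = mk⇔ (to ∘ subst Occ max≡z) (subst Occ (sym max≡z) ∘ from)
  where
  Occ : ℕ → Set
  Occ m = a < m × m < c × All (_< m) L × All (λ x → x ≡ m ⊎ a < x) (z ∷ zs)
  to : Occ z → (a < z × z < c × All (_< z) L × All (Between a z) zs) ⊎ (a < z × Occ132 (z ∷ L) a c zs)
  to (a<z , z<c , L<z , _ ∷ rest) = inj₁ (a<z , z<c , L<z , All.tabulate λ {x} x∈ →
    [ (λ x≡z → contradiction (subst (_∈ zs) x≡z x∈) z∉zs)
    , (λ a<x → a<x , ≤∧≢⇒< (≤-trans (≤-maximum x∈) m≤z) (λ x≡z → z∉zs (subst (_∈ zs) x≡z x∈))) ]′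
    (All.lookup rest x∈))
  from : (a < z × z < c × All (_< z) L × All (Between a z) zs) ⊎ (a < z × Occ132 (z ∷ L) a c zs) → Occ z
  from (inj₁ (a<z , z<c , L<z , btws))    = a<z , z<c , L<z , inj₁ refl ∷ All.map (inj₂ ∘ proj₁) btws
  from (inj₂ (_ , (_ , _ , z<m ∷ _ , _))) = contradiction z<m (≤⇒≯ m≤z)
... | inj₂ (z<m , max≡m) = mk⇔ (to ∘ subst Occ max≡m) (subst Occ (sym max≡m) ∘ from)
  where
  Occ : ℕ → Set
  Occ m = a < m × m < c × All (_< m) L × All (λ x → x ≡ m ⊎ a < x) (z ∷ zs)
  to : Occ (maximum zs) → (a < z × z < c × All (_< z) L × All (Between a z) zs) ⊎ (a < z × Occ132 (z ∷ L) a c zs)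
  to (a<m , m<c , L<m , inj₁ z≡m ∷ _)    = contradiction z≡m (<⇒≢ z<m)
  to (a<m , m<c , L<m , inj₂ a<z ∷ rest) = inj₂ (a<z , a<m , m<c , z<m ∷ L<m , rest)
  from : (a < z × z < c × All (_< z) L × All (Between a z) zs) ⊎ (a < z × Occ132 (z ∷ L) a c zs) → Occ (maximum zs)
  from (inj₁ (a<z , z<c , L<z , btws))           = contradiction z<m
                                                     (<⇒≯ (proj₂ (All.lookup btws (<maximum⇒∈ (<-trans a<z z<m)))))
  from (inj₂ (a<z , a<m , m<c , _ ∷ L<m , rest)) = a<m , m<c , L<m , inj₂ a<z ∷ rest

-- Counting occurrences over index triples

sumBelow : ℕ → (ℕ → ℕ) → ℕ
sumBelow zero    f = 0
sumBelow (suc n) f = f 0 + sumBelow n (f ∘ suc)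

sumBelow-cong< : ∀ n {f g : ℕ → ℕ} → (∀ i → i < n → f i ≡ g i) → sumBelow n f ≡ sumBelow n g
sumBelow-cong< zero    f≗g = refl
sumBelow-cong< (suc n) f≗g = cong₂ _+_ (f≗g 0 (s≤s z≤n)) (sumBelow-cong< n (λ i i<n → f≗g (suc i) (s≤s i<n)))

sumBelow-cong : ∀ n {f g : ℕ → ℕ} → (∀ i → f i ≡ g i) → sumBelow n f ≡ sumBelow n g
sumBelow-cong n f≗g = sumBelow-cong< n (λ i _ → f≗g i)

sumBelow-0 : ∀ n {f : ℕ → ℕ} → (∀ i → f i ≡ 0) → sumBelow n f ≡ 0
sumBelow-0 zero    f≗0 = refl
sumBelow-0 (suc n) f≗0 rewrite f≗0 0 = sumBelow-0 n (f≗0 ∘ suc)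

count₁ : ℕ → (ℕ → Bool) → ℕ
count₁ n P = sumBelow n (𝟙 ∘ P)

count₂ : ℕ → (ℕ → ℕ → Bool) → ℕ
count₂ n P = sumBelow n λ j → sumBelow n λ k → 𝟙 (((j <ᵇ k) ∧ true) ∧ P j k)

-- The guard is increasingᵇ (suc i ∷ suc j ∷ suc k ∷ []) unfolded, hence the trailing true.
count₃ : ℕ → (ℕ → ℕ → ℕ → Bool) → ℕ
count₃ n P = sumBelow n λ i → sumBelow n λ j → sumBelow n λ k → 𝟙 (((i <ᵇ j) ∧ ((j <ᵇ k) ∧ true)) ∧ P i j k)

count₁-∧ : ∀ n b (P : ℕ → Bool) → count₁ n (λ k → b ∧ P k) ≡ (if b then count₁ n P else 0)
count₁-∧ n true  P = refl
count₁-∧ n false P = sumBelow-0 n (λ _ → refl)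

count₃-suc : ∀ n P →
  count₃ (suc n) P ≡ count₂ n (λ j k → P 0 (suc j) (suc k)) + count₃ n (λ i j k → P (suc i) (suc j) (suc k))
count₃-suc n P =
  cong₂ _+_ (cong (_+ count₂ n (λ j k → P 0 (suc j) (suc k))) (sumBelow-0 (suc n) (λ _ → refl)))
            (sumBelow-cong n λ i →
              trans (cong (_+ rest i) (sumBelow-0 (suc n) (λ _ → refl)))
                    (sumBelow-cong n λ j → cong (_+ inner i j) (no-k i j)))
  where
  rest : ℕ → ℕ
  rest i = sumBelow n λ j → sumBelow (suc n) λ k → 𝟙 (((i <ᵇ j) ∧ ((suc j <ᵇ k) ∧ true)) ∧ P (suc i) (suc j) k)
  inner : ℕ → ℕ → ℕ
  inner i j = sumBelow n λ k → 𝟙 (((i <ᵇ j) ∧ ((j <ᵇ k) ∧ true)) ∧ P (suc i) (suc j) (suc k))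
  no-k : ∀ i j → 𝟙 (((i <ᵇ j) ∧ (false ∧ true)) ∧ P (suc i) (suc j) 0) ≡ 0
  no-k i j rewrite ∧-zeroʳ (i <ᵇ j) = refl

-- Positions are 0-based from here on: letter π i is the (i+1)-st letter of π.
letter : List ℕ → ℕ → ℕ
letter π i = at π (suc i)

allAt : (ℕ → ℕ → Bool) → List ℕ → Bool
allAt p []       = true
allAt p (x ∷ xs) = p 0 x ∧ allAt (p ∘ suc) xs

allAt-const : ∀ (p : ℕ → Bool) zs → allAt (λ _ → p) zs ≡ all p zs
allAt-const p []       = refl
allAt-const p (z ∷ zs) = cong (p z ∧_) (allAt-const p zs)

does-all? : ∀ {P : ℕ → Set} (P? : ∀ x → Dec (P x)) xs → does (All.all? P? xs) ≡ all (does ∘ P?) xs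
does-all? P? []       = refl
does-all? P? (x ∷ xs) = cong (does (P? x) ∧_) (does-all? P? xs)

betweenᵇ : ℕ → ℕ → ℕ → Bool
betweenᵇ a b z = (a <ᵇ z) ∧ (z <ᵇ b)

-- The shaded boxes of R48 for the letter z at position m, when the positions i < j < k carry the values
-- lo < mid < hi in some order: letters left of i lie below mid, and letters right of j, apart from the one
-- at k, lie strictly between lo and mid.
afterOK : ℕ → ℕ → ℕ → ℕ → ℕ → ℕ → Bool
afterOK j k lo mid m z = not (j <ᵇ m) ∨ ((m ≡ᵇ k) ∨ betweenᵇ lo mid z)

outsideOK : ℕ → ℕ → ℕ → ℕ → ℕ → ℕ → ℕ → Bool
outsideOK i j k lo mid m z = (not (m <ᵇ i) ∨ (z <ᵇ mid)) ∧ afterOK j k lo mid m z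

occursAt : List ℕ → List ℕ → ℕ → ℕ → ℕ → ℕ → ℕ → ℕ → Bool
occursAt L π i j k lo mid hi = (lo <ᵇ mid) ∧ ((mid <ᵇ hi) ∧ (all (_<ᵇ mid) L ∧ allAt (outsideOK i j k lo mid) π))

pairAt : List ℕ → ℕ → List ℕ → ℕ → ℕ → ℕ → ℕ → Bool
pairAt L a ys j k mid hi = (a <ᵇ mid) ∧ ((mid <ᵇ hi) ∧ (all (_<ᵇ mid) L ∧ allAt (afterOK j k a mid) ys))

tail123At : ℕ → ℕ → List ℕ → ℕ → Bool
tail123At a b zs k = (b <ᵇ letter zs k) ∧ allAt (λ m z → (m ≡ᵇ k) ∨ betweenᵇ a b z) zs

tail132At : List ℕ → ℕ → ℕ → List ℕ → ℕ → Bool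
tail132At L a c zs k = (a <ᵇ w) ∧ ((w <ᵇ c) ∧ (all (_<ᵇ w) L ∧ allAt (λ m z → (m ≡ᵇ k) ∨ betweenᵇ a w z) zs))
  where
  w : ℕ
  w = letter zs k

∧-left-comm : ∀ x y z → x ∧ (y ∧ z) ≡ y ∧ (x ∧ z)
∧-left-comm false false z = refl
∧-left-comm false true  z = refl
∧-left-comm true  y     z = refl

∧-skip : ∀ A B C D E F → A ∧ (B ∧ (C ∧ ((D ∧ E) ∧ F))) ≡ D ∧ (A ∧ (B ∧ ((E ∧ C) ∧ F)))
∧-skip A B C false E F rewrite ∧-zeroʳ C | ∧-zeroʳ B | ∧-zeroʳ A = refl
∧-skip A B C true  E F = cong (λ t → A ∧ (B ∧ t)) (trans (∧-left-comm C E F) (sym (∧-assoc E C F)))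

count₃-cong< : ∀ n {P Q : ℕ → ℕ → ℕ → Bool} → (∀ i j k → i < j → j < k → k < n → P i j k ≡ Q i j k) →
               count₃ n P ≡ count₃ n Q
count₃-cong< n P≗Q = sumBelow-cong< n λ i _ → sumBelow-cong< n λ j _ → sumBelow-cong< n λ k k<n →
  cong 𝟙 (guarded (i <ᵇ j) (j <ᵇ k) (λ i<j j<k → P≗Q i j k (<ᵇ⇒< i j i<j) (<ᵇ⇒< j k j<k) k<n))
  where
  guarded : ∀ a b {X Y} → (T a → T b → X ≡ Y) → (a ∧ (b ∧ true)) ∧ X ≡ (a ∧ (b ∧ true)) ∧ Y
  guarded false b     _   = refl
  guarded true  false _   = refl
  guarded true  true  X≡Y = X≡Y _ _

count₁-tail123 : ∀ a b zs → Unique zs → count₁ (length zs) (tail123At a b zs) ≡ ⟦ tail123? a b zs ⟧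
count₁-tail123 a b []       _ = refl
count₁-tail123 a b (z ∷ zs) u = begin
  𝟙 ((b <ᵇ z) ∧ allAt (λ _ → betweenᵇ a b) zs) + count₁ len (λ k → tail123At a b (z ∷ zs) (suc k))
    ≡⟨ cong₂ _+_ first≡ (sumBelow-cong len λ k → cong 𝟙 (∧-left-comm (b <ᵇ letter zs k) (betweenᵇ a b z) _)) ⟩
  ⟦ first? ⟧ + count₁ len (λ k → betweenᵇ a b z ∧ tail123At a b zs k)
    ≡⟨ cong (⟦ first? ⟧ +_) (count₁-∧ len (betweenᵇ a b z) (tail123At a b zs)) ⟩
  ⟦ first? ⟧ + (if does (between? a b z) then count₁ len (tail123At a b zs) else 0)
    ≡⟨ cong (λ t → ⟦ first? ⟧ + (if does (between? a b z) then t else 0)) (count₁-tail123 a b zs (AllPairs.tail u)) ⟩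
  ⟦ first? ⟧ + (if does (between? a b z) then ⟦ tail123? a b zs ⟧ else 0)
    ≡⟨ cong (⟦ first? ⟧ +_) (if-⟦⟧ (between? a b z) (tail123? a b zs)) ⟩
  ⟦ first? ⟧ + ⟦ later? ⟧
    ≡⟨ ⟦⟧-⊎ first? later? (tail123? a b (z ∷ zs)) disjoint (Tail123-∷ (head∉tail u)) ⟩
  ⟦ tail123? a b (z ∷ zs) ⟧ ∎
  where
  open ≡-Reasoning
  len : ℕ
  len = length zs
  first? : Dec (b < z × All (Between a b) zs)
  first? = b <? z ×-dec All.all? (between? a b) zs
  later? : Dec (Between a b z × Tail123 a b zs)
  later? = between? a b z ×-dec tail123? a b zs
  first≡ : 𝟙 ((b <ᵇ z) ∧ allAt (λ _ → betweenᵇ a b) zs) ≡ ⟦ first? ⟧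
  first≡ = cong (λ t → 𝟙 ((b <ᵇ z) ∧ t))
                (trans (allAt-const (betweenᵇ a b) zs) (sym (does-all? (between? a b) zs)))
  disjoint : ¬ ((b < z × All (Between a b) zs) × (Between a b z × Tail123 a b zs))
  disjoint ((b<z , _) , ((_ , z<b) , _)) = <-asym b<z z<b

count₁-tail132 : ∀ L a c zs → Unique zs → count₁ (length zs) (tail132At L a c zs) ≡ ⟦ occ132? L a c zs ⟧
count₁-tail132 L a c []       _ = refl
count₁-tail132 L a c (z ∷ zs) u = begin
  𝟙 ((a <ᵇ z) ∧ ((z <ᵇ c) ∧ (all (_<ᵇ z) L ∧ allAt (λ _ → betweenᵇ a z) zs)))
    + count₁ len (λ k → tail132At L a c (z ∷ zs) (suc k))
    ≡⟨ cong₂ _+_ first≡ (sumBelow-cong len λ k → cong 𝟙 (skip k)) ⟩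
  ⟦ first? ⟧ + count₁ len (λ k → (a <ᵇ z) ∧ tail132At (z ∷ L) a c zs k)
    ≡⟨ cong (⟦ first? ⟧ +_) (count₁-∧ len (a <ᵇ z) (tail132At (z ∷ L) a c zs)) ⟩
  ⟦ first? ⟧ + (if does (a <? z) then count₁ len (tail132At (z ∷ L) a c zs) else 0)
    ≡⟨ cong (λ t → ⟦ first? ⟧ + (if does (a <? z) then t else 0)) (count₁-tail132 (z ∷ L) a c zs (AllPairs.tail u)) ⟩
  ⟦ first? ⟧ + (if does (a <? z) then ⟦ occ132? (z ∷ L) a c zs ⟧ else 0)
    ≡⟨ cong (⟦ first? ⟧ +_) (if-⟦⟧ (a <? z) (occ132? (z ∷ L) a c zs)) ⟩
  ⟦ first? ⟧ + ⟦ later? ⟧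
    ≡⟨ ⟦⟧-⊎ first? later? (occ132? L a c (z ∷ zs)) disjoint (Occ132-∷ (head∉tail u)) ⟩
  ⟦ occ132? L a c (z ∷ zs) ⟧ ∎
  where
  open ≡-Reasoning
  len : ℕ
  len = length zs
  first? : Dec (a < z × z < c × All (_< z) L × All (Between a z) zs)
  first? = a <? z ×-dec z <? c ×-dec All.all? (_<? z) L ×-dec All.all? (between? a z) zs
  later? : Dec (a < z × Occ132 (z ∷ L) a c zs)
  later? = a <? z ×-dec occ132? (z ∷ L) a c zs
  first≡ : 𝟙 ((a <ᵇ z) ∧ ((z <ᵇ c) ∧ (all (_<ᵇ z) L ∧ allAt (λ _ → betweenᵇ a z) zs))) ≡ ⟦ first? ⟧
  first≡ = cong (λ t → 𝟙 ((a <ᵇ z) ∧ ((z <ᵇ c) ∧ t)))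
                (cong₂ _∧_ (sym (does-all? (_<? z) L))
                           (trans (allAt-const (betweenᵇ a z) zs) (sym (does-all? (between? a z) zs))))
  disjoint : ¬ ((a < z × z < c × All (_< z) L × All (Between a z) zs) × (a < z × Occ132 (z ∷ L) a c zs))
  disjoint ((_ , _ , _ , btws) , (_ , a<m , _ , z<m ∷ _ , _)) = <-asym z<m (proj₂ (All.lookup btws (<maximum⇒∈ a<m)))
  skip : ∀ k → tail132At L a c (z ∷ zs) (suc k) ≡ (a <ᵇ z) ∧ tail132At (z ∷ L) a c zs k
  skip k = ∧-skip (a <ᵇ w) (w <ᵇ c) (all (_<ᵇ w) L) (a <ᵇ z) (z <ᵇ w)
                  (allAt (λ m x → (m ≡ᵇ k) ∨ betweenᵇ a w x) zs)
    where
    w : ℕ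
    w = letter zs k

count₂-pair123 : ∀ L a ys → Unique ys →
                 count₂ (length ys) (λ j k → pairAt L a ys j k (letter ys j) (letter ys k)) ≡ occ123From L a ys
count₂-pair123 L a []       _ = refl
count₂-pair123 L a (y ∷ ys) u = cong₂ _+_ first (count₂-pair123 L a ys (AllPairs.tail u))
  where
  first : count₁ (length ys) (λ k → pairAt L a (y ∷ ys) 0 (suc k) y (letter ys k)) ≡ ⟦ occ123? L a y ys ⟧
  first = begin
    count₁ (length ys) (λ k → (a <ᵇ y) ∧ ((y <ᵇ letter ys k) ∧ (all (_<ᵇ y) L ∧ rest k)))
      ≡⟨ sumBelow-cong (length ys) (λ k → cong (λ t → 𝟙 ((a <ᵇ y) ∧ t))
                                              (∧-left-comm (y <ᵇ letter ys k) (all (_<ᵇ y) L) (rest k))) ⟩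
    count₁ (length ys) (λ k → (a <ᵇ y) ∧ (all (_<ᵇ y) L ∧ tail123At a y ys k))
      ≡⟨ count₁-∧ (length ys) (a <ᵇ y) _ ⟩
    (if a <ᵇ y then count₁ (length ys) (λ k → all (_<ᵇ y) L ∧ tail123At a y ys k) else 0)
      ≡⟨ cong (if a <ᵇ y then_else 0) (count₁-∧ (length ys) (all (_<ᵇ y) L) _) ⟩
    (if a <ᵇ y then (if all (_<ᵇ y) L then count₁ (length ys) (tail123At a y ys) else 0) else 0)
      ≡⟨ cong₂ (λ b t → if a <ᵇ y then (if b then t else 0) else 0)
               (sym (does-all? (_<? y) L)) (count₁-tail123 a y ys (AllPairs.tail u)) ⟩
    (if does (a <? y) then (if does (All.all? (_<? y) L) then ⟦ tail123? a y ys ⟧ else 0) else 0)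
      ≡⟨ cong (if a <ᵇ y then_else 0) (if-⟦⟧ (All.all? (_<? y) L) (tail123? a y ys)) ⟩
    (if does (a <? y) then ⟦ All.all? (_<? y) L ×-dec tail123? a y ys ⟧ else 0)
      ≡⟨ if-⟦⟧ (a <? y) (All.all? (_<? y) L ×-dec tail123? a y ys) ⟩
    ⟦ occ123? L a y ys ⟧ ∎
    where
    open ≡-Reasoning
    rest : ℕ → Bool
    rest k = allAt (λ m z → (m ≡ᵇ k) ∨ betweenᵇ a y z) ys

count₂-pair132 : ∀ L a ys → Unique ys →
                 count₂ (length ys) (λ j k → pairAt L a ys j k (letter ys k) (letter ys j)) ≡ occ132From L a ys
count₂-pair132 L a []       _ = refl
count₂-pair132 L a (y ∷ ys) u =
  cong₂ _+_ (count₁-tail132 L a y ys (AllPairs.tail u)) (count₂-pair132 L a ys (AllPairs.tail u))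

occursAt-shift : ∀ L x xs i j k lo mid hi →
                 occursAt L (x ∷ xs) (suc i) (suc j) (suc k) lo mid hi ≡ occursAt (x ∷ L) xs i j k lo mid hi
occursAt-shift L x xs i j k lo mid hi =
  cong (λ t → (lo <ᵇ mid) ∧ ((mid <ᵇ hi) ∧ t)) (shift (all (_<ᵇ mid) L) (x <ᵇ mid) _)
  where
  shift : ∀ C D E → C ∧ ((D ∧ true) ∧ E) ≡ (D ∧ C) ∧ E
  shift C false E rewrite ∧-zeroʳ C = refl
  shift C true  E = refl

count₃-occurs123 : ∀ L π → Unique π →
  count₃ (length π) (λ i j k → occursAt L π i j k (letter π i) (letter π j) (letter π k)) ≡ occ123 L π
count₃-occurs123 L []       _ = refl
count₃-occurs123 L (x ∷ xs) u = begin
  count₃ (suc n) P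
    ≡⟨ count₃-suc n P ⟩
  count₂ n (λ j k → pairAt L x xs j k (letter xs j) (letter xs k))
    + count₃ n (λ i j k → occursAt L (x ∷ xs) (suc i) (suc j) (suc k) (letter xs i) (letter xs j) (letter xs k))
    ≡⟨ cong₂ _+_ (count₂-pair123 L x xs u′)
                 (count₃-cong< n λ i j k _ _ _ → occursAt-shift L x xs i j k (letter xs i) (letter xs j) (letter xs k)) ⟩
  occ123From L x xs + count₃ n (λ i j k → occursAt (x ∷ L) xs i j k (letter xs i) (letter xs j) (letter xs k))
    ≡⟨ cong (occ123From L x xs +_) (count₃-occurs123 (x ∷ L) xs u′) ⟩
  occ123 L (x ∷ xs) ∎
  where
  open ≡-Reasoning
  n : ℕ
  n = length xs
  P : ℕ → ℕ → ℕ → Bool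
  P i j k = occursAt L (x ∷ xs) i j k (letter (x ∷ xs) i) (letter (x ∷ xs) j) (letter (x ∷ xs) k)
  u′ : Unique xs
  u′ = AllPairs.tail u

count₃-occurs132 : ∀ L π → Unique π →
  count₃ (length π) (λ i j k → occursAt L π i j k (letter π i) (letter π k) (letter π j)) ≡ occ132 L π
count₃-occurs132 L []       _ = refl
count₃-occurs132 L (x ∷ xs) u = begin
  count₃ (suc n) P
    ≡⟨ count₃-suc n P ⟩
  count₂ n (λ j k → pairAt L x xs j k (letter xs k) (letter xs j))
    + count₃ n (λ i j k → occursAt L (x ∷ xs) (suc i) (suc j) (suc k) (letter xs i) (letter xs k) (letter xs j))
    ≡⟨ cong₂ _+_ (count₂-pair132 L x xs u′)
                 (count₃-cong< n λ i j k _ _ _ → occursAt-shift L x xs i j k (letter xs i) (letter xs k) (letter xs j)) ⟩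
  occ132From L x xs + count₃ n (λ i j k → occursAt (x ∷ L) xs i j k (letter xs i) (letter xs k) (letter xs j))
    ≡⟨ cong (occ132From L x xs +_) (count₃-occurs132 (x ∷ L) xs u′) ⟩
  occ132 L (x ∷ xs) ∎
  where
  open ≡-Reasoning
  n : ℕ
  n = length xs
  P : ℕ → ℕ → ℕ → Bool
  P i j k = occursAt L (x ∷ xs) i j k (letter (x ∷ xs) i) (letter (x ∷ xs) k) (letter (x ∷ xs) j)
  u′ : Unique xs
  u′ = AllPairs.tail u

-- Occurrences at a fixed index triple

<ᵇ-true : ∀ {m n} → m < n → (m <ᵇ n) ≡ true
<ᵇ-true {m} {n} m<n with m <ᵇ n | <⇒<ᵇ m<n
... | true | _ = refl

<ᵇ-false : ∀ {m n} → n ≤ m → (m <ᵇ n) ≡ false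
<ᵇ-false {m} {n} n≤m with m <ᵇ n | <ᵇ⇒< m n
... | false | _   = refl
... | true  | m<n = contradiction (m<n _) (≤⇒≯ n≤m)

≡ᵇ-false : ∀ {m n} → m ≢ n → (m ≡ᵇ n) ≡ false
≡ᵇ-false {m} {n} m≢n with m ≡ᵇ n | ≡ᵇ⇒≡ m n
... | false | _    = refl
... | true  | m≡n = contradiction (m≡n _) m≢n

≡ᵇ-refl : ∀ n → (n ≡ᵇ n) ≡ true
≡ᵇ-refl n with n ≡ᵇ n | ≡⇒≡ᵇ n n refl
... | true | _ = refl

<ᵇ-flip : ∀ {m n} → m ≢ n → (n <ᵇ m) ≡ not (m <ᵇ n)
<ᵇ-flip {m} {n} m≢n with <-cmp m n
... | tri< m<n _ _ rewrite <ᵇ-true m<n | <ᵇ-false (<⇒≤ m<n) = refl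
... | tri≈ _ m≡n _ = contradiction m≡n m≢n
... | tri> _ _ n<m rewrite <ᵇ-true n<m | <ᵇ-false (<⇒≤ n<m) = refl

<ᵇ-≡true : ∀ {m n} → (m <ᵇ n) ≡ true → m < n
<ᵇ-≡true {m} {n} eq = <ᵇ⇒< m n (subst T (sym eq) _)

<ᵇ-≡false : ∀ {m n} → (m <ᵇ n) ≡ false → n ≤ m
<ᵇ-≡false eq = ≮⇒≥ λ m<n → contradiction (trans (sym (<ᵇ-true m<n)) eq) λ ()

anyAt : (ℕ → ℕ → Bool) → List ℕ → Bool
anyAt p []       = false
anyAt p (x ∷ xs) = p 0 x ∨ anyAt (p ∘ suc) xs

any-map : ∀ (p : ℕ → Bool) (f : ℕ → ℕ) xs → any p (map f xs) ≡ any (p ∘ f) xs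
any-map p f []       = refl
any-map p f (x ∷ xs) = cong (p (f x) ∨_) (any-map p f xs)

any-positions : ∀ π (p : ℕ → ℕ → Bool) → any (λ m → p m (at π (suc m))) (upTo (length π)) ≡ anyAt p π
any-positions []       p = refl
any-positions (x ∷ xs) p = cong (p 0 x ∨_) (begin
  any q (applyUpTo suc (length xs))   ≡⟨ cong (any q) (map-upTo suc (length xs)) ⟨
  any q (map suc (upTo (length xs)))  ≡⟨ any-map q suc (upTo (length xs)) ⟩
  any (q ∘ suc) (upTo (length xs))    ≡⟨ any-positions xs (p ∘ suc) ⟩
  anyAt (p ∘ suc) xs                  ∎)
  where
  open ≡-Reasoning
  q : ℕ → Bool
  q m = p m (at (x ∷ xs) (suc m))

not-anyAt : ∀ (p : ℕ → ℕ → Bool) π → not (anyAt p π) ≡ allAt (λ m z → not (p m z)) π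
not-anyAt p []       = refl
not-anyAt p (x ∷ xs) with p 0 x
... | true  = refl
... | false = not-anyAt (p ∘ suc) xs

allAt-∧ : ∀ (p q : ℕ → ℕ → Bool) π → allAt p π ∧ allAt q π ≡ allAt (λ m z → p m z ∧ q m z) π
allAt-∧ p q []       = refl
allAt-∧ p q (x ∷ xs) =
  trans (interchange (p 0 x) (q 0 x) _ _) (cong ((p 0 x ∧ q 0 x) ∧_) (allAt-∧ (p ∘ suc) (q ∘ suc) xs))
  where
  interchange : ∀ a b A B → (a ∧ A) ∧ (b ∧ B) ≡ (a ∧ b) ∧ (A ∧ B)
  interchange false b     A B = refl
  interchange true  false A B = ∧-zeroʳ A
  interchange true  true  A B = refl

allAt-true : ∀ π → allAt (λ _ _ → true) π ≡ true
allAt-true []       = refl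
allAt-true (x ∷ xs) = allAt-true xs

boxHit : List ℕ → List ℕ → ℕ → ℕ → ℕ → ℕ → Bool
boxHit I V a b m z = (nth I a <ᵇ m) ∧ ((m <ᵇ nth I (suc a)) ∧ ((nth V b <ᵇ z) ∧ (z <ᵇ nth V (suc b))))

boxesEmptyAt : List ℕ → List ℕ → List (ℕ × ℕ) → ℕ → ℕ → Bool
boxesEmptyAt I V []             m z = true
boxesEmptyAt I V ((a , b) ∷ bs) m z = not (boxHit I V a b (suc m) z) ∧ boxesEmptyAt I V bs m z

all-boxEmpty : ∀ π I V bs → all (boxEmptyᵇ π I V) bs ≡ allAt (boxesEmptyAt I V bs) π
all-boxEmpty π I V []             = sym (allAt-true π)
all-boxEmpty π I V ((a , b) ∷ bs) = trans
  (cong₂ _∧_ (cong not (trans (any-map (λ m → hit m (at π m)) suc (upTo (length π)))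
                              (any-positions π (λ m → hit (suc m)))))
             (all-boxEmpty π I V bs))
  (trans (cong (_∧ allAt (boxesEmptyAt I V bs) π) (not-anyAt (λ m → hit (suc m)) π))
         (allAt-∧ (λ m z → not (boxHit I V a b (suc m) z)) (boxesEmptyAt I V bs) π))
  where
  hit : ℕ → ℕ → Bool
  hit = boxHit I V a b

module _ {lo mid hi n z : ℕ} (lo<mid : lo < mid) (mid<hi : mid < hi) (z≤n′ : z ≤ n)
         (fresh : z ≢ lo × z ≢ mid × z ≢ hi) where

  private
    z<1+n : z < suc n
    z<1+n = s≤s z≤n′
    z≢lo : z ≢ lo
    z≢lo = proj₁ fresh
    z≢mid : z ≢ mid
    z≢mid = proj₁ (proj₂ fresh)
    z≢hi : z ≢ hi
    z≢hi = proj₂ (proj₂ fresh)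

  left-boxes : not (betweenᵇ mid hi z) ∧ (not (betweenᵇ hi (suc n) z) ∧ true) ≡ (z <ᵇ mid) ∧ true
  left-boxes with <-cmp z mid | <-cmp z hi
  ... | tri≈ _ z≡mid _ | _ = contradiction z≡mid z≢mid
  ... | _ | tri≈ _ z≡hi _  = contradiction z≡hi z≢hi
  ... | tri< z<mid _ _ | _
    rewrite <ᵇ-false (<⇒≤ z<mid) | <ᵇ-false (<⇒≤ (<-trans z<mid mid<hi)) | <ᵇ-true z<mid = refl
  ... | tri> _ _ mid<z | tri< z<hi _ _
    rewrite <ᵇ-true mid<z | <ᵇ-true z<hi | <ᵇ-false (<⇒≤ mid<z) = refl
  ... | tri> _ _ mid<z | tri> _ _ hi<z
    rewrite <ᵇ-true mid<z | <ᵇ-false (<⇒≤ hi<z) | <ᵇ-true hi<z | <ᵇ-true z<1+n | <ᵇ-false (<⇒≤ mid<z) = refl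

  right-boxes : 0 < z →
    not (betweenᵇ 0 lo z) ∧ (not (betweenᵇ mid hi z) ∧ (not (betweenᵇ hi (suc n) z) ∧ true)) ≡ betweenᵇ lo mid z
  right-boxes z>0 with <-cmp z lo | <-cmp z mid | <-cmp z hi
  ... | tri≈ _ z≡lo _ | _ | _ = contradiction z≡lo z≢lo
  ... | _ | tri≈ _ z≡mid _ | _ = contradiction z≡mid z≢mid
  ... | _ | _ | tri≈ _ z≡hi _  = contradiction z≡hi z≢hi
  ... | tri< z<lo _ _ | _ | _
    rewrite <ᵇ-true z>0 | <ᵇ-true z<lo | <ᵇ-false (<⇒≤ z<lo) = refl
  ... | tri> _ _ lo<z | tri< z<mid _ _ | _
    rewrite <ᵇ-true z>0 | <ᵇ-false (<⇒≤ lo<z) | <ᵇ-false (<⇒≤ z<mid) | <ᵇ-false (<⇒≤ (<-trans z<mid mid<hi))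
          | <ᵇ-true lo<z | <ᵇ-true z<mid = refl
  ... | tri> _ _ lo<z | tri> _ _ mid<z | tri< z<hi _ _
    rewrite <ᵇ-true z>0 | <ᵇ-false (<⇒≤ lo<z) | <ᵇ-true lo<z | <ᵇ-true mid<z | <ᵇ-true z<hi
          | <ᵇ-false (<⇒≤ mid<z) = refl
  ... | tri> _ _ lo<z | tri> _ _ mid<z | tri> _ _ hi<z
    rewrite <ᵇ-true z>0 | <ᵇ-false (<⇒≤ lo<z) | <ᵇ-true lo<z | <ᵇ-true mid<z | <ᵇ-false (<⇒≤ hi<z) | <ᵇ-true hi<z
          | <ᵇ-true z<1+n | <ᵇ-false (<⇒≤ mid<z) = refl

boxes48≡outsideOK : ∀ {i j k lo mid hi n m z} → i < j → j < k → m < n → lo < mid → mid < hi → 0 < z → z ≤ n →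
  (m ≢ i → m ≢ j → m ≢ k → z ≢ lo × z ≢ mid × z ≢ hi) →
  boxesEmptyAt (extend n (suc i ∷ suc j ∷ suc k ∷ [])) (extend n (lo ∷ mid ∷ hi ∷ [])) R48 m z ≡
  outsideOK i j k lo mid m z
boxes48≡outsideOK {i} {j} {k} {m = m} i<j j<k m<n lo<mid mid<hi z>0 z≤n′ fresh with m <? i
... | yes m<i
  rewrite <ᵇ-true m<i | <ᵇ-false (<⇒≤ (<-trans m<i i<j)) | <ᵇ-false (<⇒≤ (<-trans (<-trans m<i i<j) j<k)) =
  left-boxes lo<mid mid<hi z≤n′ (fresh (<⇒≢ m<i) (<⇒≢ (<-trans m<i i<j)) (<⇒≢ (<-trans (<-trans m<i i<j) j<k)))
... | no m≮i with j <? m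
...   | no j≮m
  rewrite <ᵇ-false (≮⇒≥ m≮i) | <ᵇ-false (≮⇒≥ j≮m) | <ᵇ-false (≤-trans (≮⇒≥ j≮m) (<⇒≤ j<k)) = refl
...   | yes j<m with <-cmp m k
...     | tri≈ _ refl _
  rewrite <ᵇ-false (≤-trans (<⇒≤ i<j) (<⇒≤ j<k)) | <ᵇ-true j<k | <ᵇ-false (≤-refl {k}) | ≡ᵇ-refl k = refl
...     | tri< m<k _ _
  rewrite <ᵇ-false (≮⇒≥ m≮i) | <ᵇ-true j<m | <ᵇ-true m<k | <ᵇ-false (<⇒≤ m<k) | ≡ᵇ-false (<⇒≢ m<k) =
  right-boxes lo<mid mid<hi z≤n′ (fresh (>⇒≢ (<-trans i<j j<m)) (>⇒≢ j<m) (<⇒≢ m<k)) z>0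
...     | tri> _ _ k<m
  rewrite <ᵇ-false (≮⇒≥ m≮i) | <ᵇ-true j<m | <ᵇ-false (<⇒≤ k<m) | <ᵇ-true k<m | <ᵇ-true m<n
        | ≡ᵇ-false (>⇒≢ k<m) =
  right-boxes lo<mid mid<hi z≤n′ (fresh (>⇒≢ (<-trans i<j j<m)) (>⇒≢ j<m) (>⇒≢ k<m)) z>0

module _ {U V W : ℕ} (U≢V : U ≢ V) (V≢W : V ≢ W) (U≢W : U ≢ W) where

  orderIso-123 : orderIsoᵇ (U ∷ V ∷ W ∷ []) (1 ∷ 2 ∷ 3 ∷ []) ≡ (U <ᵇ V) ∧ (V <ᵇ W)
  orderIso-123
    rewrite <ᵇ-false (≤-refl {U}) | <ᵇ-false (≤-refl {V}) | <ᵇ-false (≤-refl {W})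
          | <ᵇ-flip U≢V | <ᵇ-flip V≢W | <ᵇ-flip U≢W
    with U <ᵇ V in uv | V <ᵇ W in vw | U <ᵇ W in uw
  ... | false | _     | _     = refl
  ... | true  | false | false = refl
  ... | true  | false | true  = refl
  ... | true  | true  | true  = refl
  ... | true  | true  | false =
    contradiction (trans (sym (<ᵇ-true (<-trans (<ᵇ-≡true {U} {V} uv) (<ᵇ-≡true {V} {W} vw)))) uw) λ ()

  orderIso-132 : orderIsoᵇ (U ∷ V ∷ W ∷ []) (1 ∷ 3 ∷ 2 ∷ []) ≡ (U <ᵇ W) ∧ (W <ᵇ V)
  orderIso-132
    rewrite <ᵇ-false (≤-refl {U}) | <ᵇ-false (≤-refl {V}) | <ᵇ-false (≤-refl {W})
          | <ᵇ-flip U≢V | <ᵇ-flip V≢W | <ᵇ-flip U≢W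
    with U <ᵇ V in uv | V <ᵇ W in vw | U <ᵇ W in uw
  ... | true  | _     | false = refl
  ... | true  | false | true  = refl
  ... | true  | true  | true  = refl
  ... | false | _     | false = refl
  ... | false | true  | true  = refl
  ... | false | false | true  =
    contradiction (trans (sym (<ᵇ-true (<-trans (<ᵇ-≡true {U} {W} uw) W<V))) uv) λ ()
    where
    W<V : W < V
    W<V = ≤∧≢⇒< (<ᵇ-≡false {V} {W} vw) (V≢W ∘ sym)

sort-sorted : ∀ {a b c} → a < b → b < c → sort (a ∷ b ∷ c ∷ []) ≡ a ∷ b ∷ c ∷ []
sort-sorted a<b b<c rewrite <ᵇ-true b<c | <ᵇ-true a<b = refl

sort-swap₂₃ : ∀ {a b c} → a < c → c < b → sort (a ∷ b ∷ c ∷ []) ≡ a ∷ c ∷ b ∷ []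
sort-swap₂₃ a<c c<b rewrite <ᵇ-false (<⇒≤ c<b) | <ᵇ-true a<c = refl

IsPermutation : List ℕ → Set
IsPermutation π = Unique π × (∀ {x} → x ∈ π → 0 < x × x ≤ length π)

letter-∈ : ∀ π {m} → m < length π → letter π m ∈ π
letter-∈ (x ∷ xs) {zero}  _         = here refl
letter-∈ (x ∷ xs) {suc m} (s≤s m<n) = there (letter-∈ xs m<n)

letter-injective : ∀ {π m m′} → Unique π → m < length π → m′ < length π → letter π m ≡ letter π m′ → m ≡ m′
letter-injective {x ∷ xs} {zero}  {zero}   _        _         _          _  = refl
letter-injective {x ∷ xs} {zero}  {suc m′} (x∉ ∷ _) _         (s≤s m′<n) eq =
  contradiction (subst (_∈ xs) (sym eq) (letter-∈ xs m′<n)) (All¬⇒¬Any x∉)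
letter-injective {x ∷ xs} {suc m} {zero}   (x∉ ∷ _) (s≤s m<n) _          eq =
  contradiction (subst (_∈ xs) eq (letter-∈ xs m<n)) (All¬⇒¬Any x∉)
letter-injective {x ∷ xs} {suc m} {suc m′} (_ ∷ u)  (s≤s m<n) (s≤s m′<n) eq = cong suc (letter-injective u m<n m′<n eq)

allAt-cong : ∀ π {p q : ℕ → ℕ → Bool} → (∀ m → m < length π → p m (letter π m) ≡ q m (letter π m)) →
             allAt p π ≡ allAt q π
allAt-cong []       p≗q = refl
allAt-cong (x ∷ xs) p≗q = cong₂ _∧_ (p≗q 0 (s≤s z≤n)) (allAt-cong xs (λ m m<n → p≗q (suc m) (s≤s m<n)))

module _ {π : List ℕ} (perm : IsPermutation π) {i j k : ℕ} (i<j : i < j) (j<k : j < k) (k<n : k < length π) where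

  private
    n U V W : ℕ
    n = length π
    U = letter π i
    V = letter π j
    W = letter π k

    j<n : j < n
    j<n = <-trans j<k k<n
    i<n : i < n
    i<n = <-trans i<j j<n

    distinct : ∀ {a b} → a < n → b < n → a ≢ b → letter π a ≢ letter π b
    distinct a<n b<n a≢b = a≢b ∘ letter-injective (proj₁ perm) a<n b<n

    U≢V : U ≢ V
    U≢V = distinct i<n j<n (<⇒≢ i<j)
    V≢W : V ≢ W
    V≢W = distinct j<n k<n (<⇒≢ j<k)
    U≢W : U ≢ W
    U≢W = distinct i<n k<n (<⇒≢ (<-trans i<j j<k))

    others : ∀ {m} → m < n → m ≢ i → m ≢ j → m ≢ k → letter π m ≢ U × letter π m ≢ V × letter π m ≢ W
    others m<n m≢i m≢j m≢k = distinct m<n i<n m≢i , distinct m<n j<n m≢j , distinct m<n k<n m≢k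

    boxes≡outsideOK : ∀ {lo mid hi} → lo < mid → mid < hi →
      (∀ {m} → m < n → m ≢ i → m ≢ j → m ≢ k → letter π m ≢ lo × letter π m ≢ mid × letter π m ≢ hi) →
      all (boxEmptyᵇ π (extend n (suc i ∷ suc j ∷ suc k ∷ [])) (extend n (lo ∷ mid ∷ hi ∷ []))) R48 ≡
      allAt (outsideOK i j k lo mid) π
    boxes≡outsideOK {lo} {mid} {hi} lo<mid mid<hi fresh =
      trans (all-boxEmpty π (extend n (suc i ∷ suc j ∷ suc k ∷ [])) (extend n (lo ∷ mid ∷ hi ∷ [])) R48)
            (allAt-cong π λ m m<n → let (z>0 , z≤n′) = proj₂ perm (letter-∈ π m<n) in
               boxes48≡outsideOK i<j j<k m<n lo<mid mid<hi z>0 z≤n′ (fresh m<n))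

  isOccurrence-123 :
    isOccurrenceᵇ (mesh (1 ∷ 2 ∷ 3 ∷ []) R48) π (suc i ∷ suc j ∷ suc k ∷ []) ≡ occursAt [] π i j k U V W
  isOccurrence-123 rewrite orderIso-123 U≢V V≢W U≢W with U <? V | V <? W
  ... | no U≮V  | _        rewrite <ᵇ-false (≮⇒≥ U≮V) = refl
  ... | yes U<V | no V≮W   rewrite <ᵇ-true U<V | <ᵇ-false (≮⇒≥ V≮W) = refl
  ... | yes U<V | yes V<W  rewrite sort-sorted U<V V<W | <ᵇ-true U<V | <ᵇ-true V<W = boxes≡outsideOK U<V V<W others

  isOccurrence-132 :
    isOccurrenceᵇ (mesh (1 ∷ 3 ∷ 2 ∷ []) R48) π (suc i ∷ suc j ∷ suc k ∷ []) ≡ occursAt [] π i j k U W V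
  isOccurrence-132 rewrite orderIso-132 U≢V V≢W U≢W with U <? W | W <? V
  ... | no U≮W  | _        rewrite <ᵇ-false (≮⇒≥ U≮W) = refl
  ... | yes U<W | no W≮V   rewrite <ᵇ-true U<W | <ᵇ-false (≮⇒≥ W≮V) = refl
  ... | yes U<W | yes W<V  rewrite sort-swap₂₃ U<W W<V | <ᵇ-true U<W | <ᵇ-true W<V =
    boxes≡outsideOK U<W W<V λ m<n m≢i m≢j m≢k →
      let (≢U , ≢V , ≢W) = others m<n m≢i m≢j m≢k in ≢U , ≢W , ≢V

-- Occurrences as counted in Defs

countWith : ∀ {X : Set} → (X → Bool) → List X → ℕ
countWith p []       = 0
countWith p (x ∷ xs) = 𝟙 (p x) + countWith p xs

sumWith : ∀ {X : Set} → (X → ℕ) → List X → ℕ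
sumWith f []       = 0
sumWith f (x ∷ xs) = f x + sumWith f xs

module _ {X : Set} where

  length-filter≡countWith : ∀ (p : X → Bool) xs → length (filter (λ x → p x Bool.≟ true) xs) ≡ countWith p xs
  length-filter≡countWith p []       = refl
  length-filter≡countWith p (x ∷ xs) with p x
  ... | true  = cong suc (length-filter≡countWith p xs)
  ... | false = length-filter≡countWith p xs

  countWith-filter : ∀ (p q : X → Bool) xs →
                     countWith p (filter (λ x → q x Bool.≟ true) xs) ≡ countWith (λ x → q x ∧ p x) xs
  countWith-filter p q []       = refl
  countWith-filter p q (x ∷ xs) with q x
  ... | true  = cong (𝟙 (p x) +_) (countWith-filter p q xs)
  ... | false = countWith-filter p q xs

  countWith-++ : ∀ (p : X → Bool) xs ys → countWith p (xs ++ ys) ≡ countWith p xs + countWith p ys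
  countWith-++ p []       ys = refl
  countWith-++ p (x ∷ xs) ys = trans (cong (𝟙 (p x) +_) (countWith-++ p xs ys)) (sym (+-assoc (𝟙 (p x)) _ _))

  countWith-map : ∀ {Y : Set} (p : X → Bool) (f : Y → X) ys → countWith p (map f ys) ≡ countWith (p ∘ f) ys
  countWith-map p f []       = refl
  countWith-map p f (y ∷ ys) = cong (𝟙 (p (f y)) +_) (countWith-map p f ys)

sumWith-cong : ∀ {X : Set} {f g : X → ℕ} xs → (∀ x → f x ≡ g x) → sumWith f xs ≡ sumWith g xs
sumWith-cong []       f≗g = refl
sumWith-cong (x ∷ xs) f≗g = cong₂ _+_ (f≗g x) (sumWith-cong xs f≗g)

sumWith-applyUpTo : ∀ (f g : ℕ → ℕ) n → sumWith f (applyUpTo g n) ≡ sumBelow n (f ∘ g)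
sumWith-applyUpTo f g zero    = refl
sumWith-applyUpTo f g (suc n) = cong (f (g 0) +_) (sumWith-applyUpTo f (g ∘ suc) n)

sumWith-range1 : ∀ (f : ℕ → ℕ) n → sumWith f (range1 n) ≡ sumBelow n (f ∘ suc)
sumWith-range1 f n = trans (sumWith-map n) (sumWith-applyUpTo (f ∘ suc) (λ i → i) n)
  where
  sumWith-map : ∀ n → sumWith f (map suc (upTo n)) ≡ sumWith (f ∘ suc) (upTo n)
  sumWith-map n = go (upTo n)
    where
    go : ∀ xs → sumWith f (map suc xs) ≡ sumWith (f ∘ suc) xs
    go []       = refl
    go (x ∷ xs) = cong (f (suc x) +_) (go xs)

words-suc : ∀ A k → words A (suc k) ≡ cartesianProductWith _∷_ A (words A k)
words-suc A k = go A
  where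
  go : ∀ B → concatMap (λ a → map (a ∷_) (words A k)) B ≡ cartesianProductWith _∷_ B (words A k)
  go []      = refl
  go (b ∷ B) = cong (map (b ∷_) (words A k) ++_) (go B)

countWith-words-suc : ∀ (p : List ℕ → Bool) A k →
                      countWith p (words A (suc k)) ≡ sumWith (λ a → countWith (p ∘ (a ∷_)) (words A k)) A
countWith-words-suc p A k rewrite words-suc A k = go A
  where
  go : ∀ B → countWith p (cartesianProductWith _∷_ B (words A k)) ≡
             sumWith (λ a → countWith (p ∘ (a ∷_)) (words A k)) B
  go []      = refl
  go (b ∷ B) = trans (countWith-++ p (map (b ∷_) (words A k)) _)
                     (cong₂ _+_ (countWith-map p (b ∷_) (words A k)) (go B))

countWith-words₃ : ∀ (p : List ℕ → Bool) n → countWith p (words (range1 n) 3) ≡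
  sumBelow n λ i → sumBelow n λ j → sumBelow n λ k → 𝟙 (p (suc i ∷ suc j ∷ suc k ∷ []))
countWith-words₃ p n = begin
  countWith p (words A 3)
    ≡⟨ countWith-words-suc p A 2 ⟩
  sumWith (λ a → countWith (p ∘ (a ∷_)) (words A 2)) A
    ≡⟨ sumWith-cong A (λ a → countWith-words-suc (p ∘ (a ∷_)) A 1) ⟩
  sumWith (λ a → sumWith (λ b → countWith (p ∘ (a ∷_) ∘ (b ∷_)) (words A 1)) A) A
    ≡⟨ sumWith-cong A (λ a → sumWith-cong A (λ b → trans (countWith-words-suc (p ∘ (a ∷_) ∘ (b ∷_)) A 0)
                                                          (sumWith-cong A (λ c → +-identityʳ _)))) ⟩
  sumWith (λ a → sumWith (λ b → sumWith (λ c → 𝟙 (p (a ∷ b ∷ c ∷ []))) A) A) A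
    ≡⟨ sumWith-cong A (λ a → sumWith-cong A (λ b → sumWith-range1 (λ c → 𝟙 (p (a ∷ b ∷ c ∷ []))) n)) ⟩
  sumWith (λ a → sumWith (λ b → sumBelow n (λ k → 𝟙 (p (a ∷ b ∷ suc k ∷ [])))) A) A
    ≡⟨ sumWith-cong A (λ a → sumWith-range1 (λ b → sumBelow n (λ k → 𝟙 (p (a ∷ b ∷ suc k ∷ [])))) n) ⟩
  sumWith (λ a → sumBelow n (λ j → sumBelow n (λ k → 𝟙 (p (a ∷ suc j ∷ suc k ∷ []))))) A
    ≡⟨ sumWith-range1 (λ a → sumBelow n (λ j → sumBelow n (λ k → 𝟙 (p (a ∷ suc j ∷ suc k ∷ []))))) n ⟩
  sumBelow n (λ i → sumBelow n λ j → sumBelow n λ k → 𝟙 (p (suc i ∷ suc j ∷ suc k ∷ []))) ∎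
  where
  open ≡-Reasoning
  A : List ℕ
  A = range1 n

occ≡count₃ : ∀ a b c R π → let p = mesh (a ∷ b ∷ c ∷ []) R in
  occ p π ≡ count₃ (length π) (λ i j k → isOccurrenceᵇ p π (suc i ∷ suc j ∷ suc k ∷ []))
occ≡count₃ a b c R π =
  trans (length-filter≡countWith (isOccurrenceᵇ p π) (indexSeqs (length π) 3))
  (trans (countWith-filter (isOccurrenceᵇ p π) increasingᵇ (words (range1 (length π)) 3))
         (countWith-words₃ (λ w → increasingᵇ w ∧ isOccurrenceᵇ p π w) (length π)))
  where
  p : MeshPattern
  p = mesh (a ∷ b ∷ c ∷ []) R

occ≡occ123 : ∀ π → IsPermutation π → occ (mesh (1 ∷ 2 ∷ 3 ∷ []) R48) π ≡ occ123 [] π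
occ≡occ123 π perm = begin
  occ (mesh (1 ∷ 2 ∷ 3 ∷ []) R48) π
    ≡⟨ occ≡count₃ 1 2 3 R48 π ⟩
  count₃ (length π) (λ i j k → isOccurrenceᵇ (mesh (1 ∷ 2 ∷ 3 ∷ []) R48) π (suc i ∷ suc j ∷ suc k ∷ []))
    ≡⟨ count₃-cong< (length π) (λ i j k → isOccurrence-123 perm) ⟩
  count₃ (length π) (λ i j k → occursAt [] π i j k (letter π i) (letter π j) (letter π k))
    ≡⟨ count₃-occurs123 [] π (proj₁ perm) ⟩
  occ123 [] π ∎
  where open ≡-Reasoning

occ≡occ132 : ∀ π → IsPermutation π → occ (mesh (1 ∷ 3 ∷ 2 ∷ []) R48) π ≡ occ132 [] π
occ≡occ132 π perm = begin
  occ (mesh (1 ∷ 3 ∷ 2 ∷ []) R48) π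
    ≡⟨ occ≡count₃ 1 3 2 R48 π ⟩
  count₃ (length π) (λ i j k → isOccurrenceᵇ (mesh (1 ∷ 3 ∷ 2 ∷ []) R48) π (suc i ∷ suc j ∷ suc k ∷ []))
    ≡⟨ count₃-cong< (length π) (λ i j k → isOccurrence-132 perm) ⟩
  count₃ (length π) (λ i j k → occursAt [] π i j k (letter π i) (letter π k) (letter π j))
    ≡⟨ count₃-occurs132 [] π (proj₁ perm) ⟩
  occ132 [] π ∎
  where open ≡-Reasoning

-- Permutations of [n]

elemᵇ⇒∈ : ∀ {x} xs → T (elemᵇ x xs) → x ∈ xs
elemᵇ⇒∈ {x} (y ∷ ys) t with Equivalence.to T-∨ t
... | inj₁ x≡ᵇy = here (≡ᵇ⇒≡ x y x≡ᵇy)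
... | inj₂ x∈ys = there (elemᵇ⇒∈ ys x∈ys)

∈⇒elemᵇ : ∀ {x xs} → x ∈ xs → T (elemᵇ x xs)
∈⇒elemᵇ {x} (here refl) = Equivalence.from T-∨ (inj₁ (≡⇒≡ᵇ x x refl))
∈⇒elemᵇ     (there x∈)  = Equivalence.from T-∨ (inj₂ (∈⇒elemᵇ x∈))

distinctᵇ⇒Unique : ∀ w → T (distinctᵇ w) → Unique w
distinctᵇ⇒Unique []       _ = []
distinctᵇ⇒Unique (x ∷ xs) t with elemᵇ x xs in eq
... | false = ¬Any⇒All¬ xs (λ x∈ → subst T eq (∈⇒elemᵇ x∈)) ∷ distinctᵇ⇒Unique xs t

Unique⇒distinctᵇ : ∀ {w} → Unique w → T (distinctᵇ w)
Unique⇒distinctᵇ []                    = _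
Unique⇒distinctᵇ {x ∷ xs} (x∉ ∷ u) with elemᵇ x xs in eq
... | false = Unique⇒distinctᵇ u
... | true  = contradiction (elemᵇ⇒∈ xs (subst T (sym eq) _)) (All¬⇒¬Any x∉)

range1-∈⁻ : ∀ {x n} → x ∈ range1 n → 0 < x × x ≤ n
range1-∈⁻ x∈ with ∈-map⁻ suc x∈
... | y , y∈ , refl = s≤s z≤n , ∈-upTo⁻ y∈

range1-∈⁺ : ∀ {x n} → 0 < x → x ≤ n → x ∈ range1 n
range1-∈⁺ {suc y} _ x≤n = ∈-map⁺ suc (∈-upTo⁺ x≤n)

range1-unique : ∀ n → Unique (range1 n)
range1-unique n = Unique.map⁺ suc-injective (Unique.upTo⁺ n)

words-∈⁻ : ∀ {w} A k → w ∈ words A k → length w ≡ k × (∀ {x} → x ∈ w → x ∈ A)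
words-∈⁻ A zero    (here refl) = refl , λ ()
words-∈⁻ A (suc k) w∈ rewrite words-suc A k with ∈-cartesianProductWith⁻ _∷_ A (words A k) w∈
... | a , w′ , a∈ , w′∈ , refl with words-∈⁻ A k w′∈
...   | length-w′ , ⊆A = cong suc length-w′ , λ { (here refl) → a∈ ; (there x∈) → ⊆A x∈ }

words-∈⁺ : ∀ A w → (∀ {x} → x ∈ w → x ∈ A) → w ∈ words A (length w)
words-∈⁺ A []      _  = here refl
words-∈⁺ A (x ∷ w) ⊆A rewrite words-suc A (length w) =
  ∈-cartesianProductWith⁺ _∷_ (⊆A (here refl)) (words-∈⁺ A w (⊆A ∘ there))

words-unique : ∀ A → Unique A → ∀ k → Unique (words A k)
words-unique A u zero    = [] ∷ []
words-unique A u (suc k) rewrite words-suc A k =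
  Unique.cartesianProductWith⁺ _∷_ ∷-injective u (words-unique A u k)

S-∈⁻ : ∀ {π} n → π ∈ S n → length π ≡ n × IsPermutation π
S-∈⁻ {π} n π∈ with ∈-filter⁻ (λ w → distinctᵇ w Bool.≟ true) {xs = words (range1 n) n} π∈
... | π∈words , distinct with words-∈⁻ (range1 n) n π∈words
...   | length-π , ⊆range =
  length-π , distinctᵇ⇒Unique π (subst T (sym distinct) _) ,
  λ x∈ → let (x>0 , x≤n) = range1-∈⁻ (⊆range x∈) in x>0 , subst (_ ≤_) (sym length-π) x≤n

S-∈⁺ : ∀ {π} n → length π ≡ n → IsPermutation π → π ∈ S n
S-∈⁺ {π} n refl (u , range) =
  ∈-filter⁺ (λ w → distinctᵇ w Bool.≟ true)
            (words-∈⁺ (range1 n) π (λ x∈ → range1-∈⁺ (proj₁ (range x∈)) (proj₂ (range x∈))))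
            (Equivalence.to T-≡ (Unique⇒distinctᵇ u))

S-unique : ∀ n → Unique (S n)
S-unique n = Unique.filter⁺ (λ w → distinctᵇ w Bool.≟ true) (words-unique (range1 n) (range1-unique n) n)

φ-IsPermutation : ∀ {π} → IsPermutation π → IsPermutation (φ π)
φ-IsPermutation {π} (u , range) =
  Unique-resp-↭ (↭-sym (φ-↭ π u)) u ,
  λ x∈ → let (x>0 , x≤n) = range (φ-∈ u x∈) in x>0 , subst (_ ≤_) (sym (↭-length (φ-↭ π u))) x≤n

φ-S : ∀ {π} n → π ∈ S n → φ π ∈ S n
φ-S {π} n π∈ with S-∈⁻ n π∈
... | length-π , perm = S-∈⁺ n (trans (↭-length (φ-↭ π (proj₁ perm))) length-π) (φ-IsPermutation perm)

Unique-map : ∀ {A B : Set} {f : A → B} {xs} → (∀ {a b} → a ∈ xs → b ∈ xs → f a ≡ f b → a ≡ b) →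
             Unique xs → Unique (map f xs)
Unique-map {xs = []}     _   []        = []
Unique-map {xs = x ∷ xs} inj (x∉ ∷ u) =
  All.map⁺ (All.tabulate λ y∈ fx≡fy → All.lookup x∉ y∈ (inj (here refl) (there y∈) fx≡fy)) ∷
  Unique-map (λ a∈ b∈ → inj (there a∈) (there b∈)) u

map-φ-S : ∀ n → map φ (S n) ↭ S n
map-φ-S n = ∼bag⇒↭ (unique∧set⇒bag (Unique-map injective (S-unique n)) (S-unique n) (mk⇔ to from))
  where
  φφ : ∀ {π} → π ∈ S n → φ (φ π) ≡ π
  φφ π∈ = φ-involutive _ (proj₁ (proj₂ (S-∈⁻ n π∈)))
  injective : ∀ {a b} → a ∈ S n → b ∈ S n → φ a ≡ φ b → a ≡ b
  injective a∈ b∈ φa≡φb = trans (sym (φφ a∈)) (trans (cong φ φa≡φb) (φφ b∈))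
  to : ∀ {π} → π ∈ map φ (S n) → π ∈ S n
  to π∈ with ∈-map⁻ φ π∈
  ... | σ , σ∈ , refl = φ-S n σ∈
  from : ∀ {π} → π ∈ S n → π ∈ map φ (S n)
  from π∈ = subst (_∈ map φ (S n)) (φφ π∈) (∈-map⁺ φ (φ-S n π∈))

occ-φ : ∀ π → IsPermutation π → occ (mesh (1 ∷ 3 ∷ 2 ∷ []) R48) (φ π) ≡ occ (mesh (1 ∷ 2 ∷ 3 ∷ []) R48) π
occ-φ π perm = begin
  occ (mesh (1 ∷ 3 ∷ 2 ∷ []) R48) (φ π)  ≡⟨ occ≡occ132 (φ π) (φ-IsPermutation perm) ⟩
  occ132 [] (φ π)                        ≡⟨ occ132-φ π (proj₁ perm) [] ⟩
  occ123 [] π                            ≡⟨ occ≡occ123 π perm ⟨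
  occ (mesh (1 ∷ 2 ∷ 3 ∷ []) R48) π      ∎
  where open ≡-Reasoning

module _ (ℓ : ℕ) where

  length-filter-map : ∀ (f : List ℕ → List ℕ) (o : List ℕ → ℕ) xs →
    length (filter (λ π → o π ℕ.≟ ℓ) (map f xs)) ≡ length (filter (λ π → o (f π) ℕ.≟ ℓ) xs)
  length-filter-map f o []       = refl
  length-filter-map f o (x ∷ xs) with o (f x) ≡ᵇ ℓ
  ... | true  = cong suc (length-filter-map f o xs)
  ... | false = length-filter-map f o xs

  length-filter-cong : ∀ (o o′ : List ℕ → ℕ) xs → (∀ {x} → x ∈ xs → o x ≡ o′ x) →
    length (filter (λ π → o π ℕ.≟ ℓ) xs) ≡ length (filter (λ π → o′ π ℕ.≟ ℓ) xs)
  length-filter-cong o o′ []       _    = refl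
  length-filter-cong o o′ (x ∷ xs) o≗o′ rewrite o≗o′ (here refl) with o′ x ≡ᵇ ℓ
  ... | true  = cong suc (length-filter-cong o o′ xs (o≗o′ ∘ there))
  ... | false = length-filter-cong o o′ xs (o≗o′ ∘ there)

theorem4p8 : mesh (1 ∷ 2 ∷ 3 ∷ []) R48 ∼d mesh (1 ∷ 3 ∷ 2 ∷ []) R48
theorem4p8 n ℓ = begin
  count p n ℓ
    ≡⟨ length-filter-cong ℓ (occ p) (occ q ∘ φ) (S n) (λ π∈ → sym (occ-φ _ (proj₂ (S-∈⁻ n π∈)))) ⟩
  length (filter (λ π → occ q (φ π) ℕ.≟ ℓ) (S n))
    ≡⟨ length-filter-map ℓ φ (occ q) (S n) ⟨
  length (filter (λ π → occ q π ℕ.≟ ℓ) (map φ (S n)))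
    ≡⟨ ↭-length (filter-↭ (λ π → occ q π ℕ.≟ ℓ) (map-φ-S n)) ⟩
  count q n ℓ ∎
  where
  open ≡-Reasoning
  p q : MeshPattern
  p = mesh (1 ∷ 2 ∷ 3 ∷ []) R48
  q = mesh (1 ∷ 3 ∷ 2 ∷ []) R48
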